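{- Let $G$ be a finite abelian group of order $n$ and let $\mathfrak T=(n_1,\dots,n_t)$ be a tower type of degree $n$. Then the flag type $T(\mathfrak T)$ is realizable for $G$ (i.e. there is a flag $\mathcal F$ of $G$ with $T_{\mathcal F}=T(\mathfrak T)$) if and only if $G$ has a filtration by subgroups \[\{1\}=G_0\subset G_1\subset\cdots\subset G_t=G\] such that $G_i/G_{i-1}$ is cyclic of order $n_i$ for all $1\le i\le t$.
   Context: For a positive integer $n$ let $[n]=\{0,\dots,n-1\}$. For a finite abelian group $G$ (written multiplicatively) of order $n$, a flag of $G$ is an indexed family $\mathcal F=\{F_i\}_{i\in[n]}$ of subsets with $\{1\}=F_0\subset F_1\subset\cdots\subset F_{n-1}=G$ and $|F_i|=i+1$. Its flag type is $T_{\mathcal F}:[n]\times[n]\to[n]$, $T_{\mathcal F}(i,j)=\min\{k\in[n]: F_iF_j\subseteq F_k\}$, where $F_iF_j=\{ab: a\in F_i, b\in F_j\}$. A tower type of degree $n$ is a tuple $(n_1,\dots,n_t)$ of integers $>1$ with $n_1\cdots n_t=n$. Every $i\in[n]$ can be written uniquely in mixed radix notation as $i=i_1+i_2n_1+i_3n_1n_2+\cdots+i_tn_1\cdots n_{t-1}$ with $0\le i_s<n_s$. Let $H=C_{n_1}\times\cdots\times C_{n_t}$ (product of cyclic groups), $e_s$ a generator of the $s$-th factor, $v_i=e_1^{i_1}\cdots e_t^{i_t}$ and $F_i=\{v_0,\dots,v_i\}$; $T(\mathfrak T)$ denotes the flag type of this flag of $H$. -}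

module Defs where

open import Level using (0ℓ)
open import Data.Nat using (ℕ; zero; suc; _+_; _*_; _≤_; _<_)
open import Data.Nat.DivMod using (_/_; _%_)
open import Data.Fin using (Fin; toℕ; inject₁)
open import Data.Fin.Subset using (Subset; _∈_; _⊆_; ∣_∣; ⁅_⁆; ⊤)
open import Data.List using (List; []; _∷_; length; lookup)
open import Data.Product using (Σ; _×_; ∃; ∃-syntax)
open import Relation.Binary.PropositionalEquality using (_≡_)
open import Algebra.Core using (Op₁; Op₂)
open import Algebra.Structures using (IsAbelianGroup)

-- A finite abelian group of order n, written multiplicatively, with
-- carrier Fin n (every finite abelian group of order n is isomorphic to
-- one of this form; all notions below are isomorphism invariant).

record FiniteAbelianGroup (n : ℕ) : Set where
  infixl 7 _∙_
  field
    _∙_ : Op₂ (Fin n)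
    ε   : Fin n
    _⁻¹ : Op₁ (Fin n)
    isAbelianGroup : IsAbelianGroup _≡_ _∙_ ε _⁻¹

IsLeast : {n : ℕ} → (Fin n → Set) → Fin n → Set
IsLeast P k = P k × (∀ k′ → P k′ → toℕ k ≤ toℕ k′)

module _ {n : ℕ} (G : FiniteAbelianGroup n) where
  open FiniteAbelianGroup G

  pow : Fin n → ℕ → Fin n
  pow g zero    = ε
  pow g (suc k) = g ∙ pow g k

  record IsFlag (F : Fin n → Subset n) : Set where
    field
      first : ∀ i → toℕ i ≡ 0 → F i ≡ ⁅ ε ⁆
      last  : ∀ i → suc (toℕ i) ≡ n → F i ≡ ⊤
      chain : ∀ i j → toℕ i ≤ toℕ j → F i ⊆ F j
      size  : ∀ i → ∣ F i ∣ ≡ suc (toℕ i)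

  ProdSub : (F : Fin n → Subset n) → Fin n → Fin n → Fin n → Set
  ProdSub F i j k = ∀ a b → a ∈ F i → b ∈ F j → (a ∙ b) ∈ F k

  FlagTypeIs : (F : Fin n → Subset n) → Fin n → Fin n → Fin n → Set
  FlagTypeIs F i j k = IsLeast (ProdSub F i j) k

  record IsSubgroup (S : Subset n) : Set where
    field
      ε-mem : ε ∈ S
      ∙-mem : ∀ a b → a ∈ S → b ∈ S → (a ∙ b) ∈ S
      ⁻¹-mem : ∀ a → a ∈ S → (a ⁻¹) ∈ S

  CyclicQuotientOfOrder : Subset n → Subset n → ℕ → Set
  CyclicQuotientOfOrder A B m =
    ∃[ g ] (g ∈ A
      × (∀ x → x ∈ A → ∃[ k ] (k < m × (x ∙ (pow g k) ⁻¹) ∈ B))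
      × (∀ k l → k < m → l < m → (pow g k ∙ (pow g l) ⁻¹) ∈ B → k ≡ l))

  record IsFiltration (ns : List ℕ) (Gs : Fin (suc (length ns)) → Subset n) : Set where
    field
      subgroup : ∀ s → IsSubgroup (Gs s)
      bottom   : ∀ s → toℕ s ≡ 0 → Gs s ≡ ⁅ ε ⁆
      top      : ∀ s → toℕ s ≡ length ns → Gs s ≡ ⊤
      incl     : ∀ (s : Fin (length ns)) → Gs (inject₁ s) ⊆ Gs (Fin.suc s)
      quotient : ∀ (s : Fin (length ns)) →
                   CyclicQuotientOfOrder (Gs (Fin.suc s)) (Gs (inject₁ s)) (lookup ns s)

  HasFiltration : List ℕ → Set
  HasFiltration ns = ∃[ Gs ] IsFiltration ns Gs

-- H = C_{n_1} × ... × C_{n_t}; the element v_i (i in mixed radix with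
-- digits i_s) is identified with its index i. Then v_a v_b = v_c where
-- c = addMR ns a b has digits (a_s + b_s) mod n_s, and F_k = {v_0..v_k}.

addMR : List ℕ → ℕ → ℕ → ℕ
addMR []            a b = 0
addMR (zero  ∷ ms)  a b = 0   -- never used (tower entries are > 1)
addMR (suc m ∷ ms)  a b =
  ((a % suc m + b % suc m) % suc m) + suc m * addMR ms (a / suc m) (b / suc m)

TowerProdSub : {n : ℕ} → List ℕ → Fin n → Fin n → Fin n → Set
TowerProdSub ns i j k =
  ∀ a b → a ≤ toℕ i → b ≤ toℕ j → addMR ns a b ≤ toℕ k

TowerTypeIs : {n : ℕ} → List ℕ → Fin n → Fin n → Fin n → Set
TowerTypeIs ns i j k = IsLeast (TowerProdSub ns i j) k

Realizable : {n : ℕ} → FiniteAbelianGroup n → List ℕ → Set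
Realizable {n} G ns =
  ∃[ F ] (IsFlag G F × (∀ i j k → (FlagTypeIs G F i j k → TowerTypeIs ns i j k)
                                 × (TowerTypeIs ns i j k → FlagTypeIs G F i j k)))

-- Both directions compare G with the tower group C_{n₁} × ⋯ × C_{nₜ} through mixed radix coordinates.
--
-- If Gₛ/Gₛ₋₁ is generated by gₛ, then a ↦ g₁^{a₁} ⋯ gₜ^{aₜ} enumerates G, and in these coordinates the
-- product is a twisted addition: digitwise addition in which each digit may receive a correction from the
-- higher ones, vanishing when these add without carry. The maximum of a twisted addition on a box
-- [0,i]×[0,j] depends only on (n₁, …, nₜ), so the flag of initial segments of this enumeration has the
-- flag type of the tower group.
--
-- Conversely, let pos x be the index at which x enters a flag of type T(𝔗), and M = n₁ ⋯ nₛ.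
-- T(M−1, M−1) = M−1 makes {x : pos x < M} closed under products, hence a subgroup Gₛ, and
-- T(M, M(k+1)−1) = M(k+2)−1 forces the element g with pos g = M to carry Gₛ by gᵏ onto the block
-- [M k, M(k+1)) for every k < nₛ₊₁. So Gₛ₊₁/Gₛ is cyclic of order nₛ₊₁, generated by g.

module Submission where

open import Defs
open import Data.Nat using (ℕ; _<_)
open import Data.List using (List)
open import Data.Nat.ListAction using (product)
open import Data.List.Relation.Unary.All using (All)
open import Relation.Binary.PropositionalEquality using (_≡_)
open import Function.Bundles using (_⇔_)

open import Data.Empty using (⊥-elim)
open import Data.Unit using (⊤; tt)
open import Data.Product using (Σ; ∃; ∃₂; _×_; _,_; proj₁; proj₂)
open import Data.Sum using (_⊎_; inj₁; inj₂; [_,_]′)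
open import Function.Base using (_∘_)
open import Function.Bundles using (mk⇔; Equivalence)
open import Function.Properties.Equivalence using () renaming (sym to ⇔-sym; trans to ⇔-trans)
open import Relation.Nullary using (Dec; yes; no; ¬_)
open import Relation.Nullary.Decidable using (_×-dec_)
open import Relation.Binary.Definitions using (tri<; tri≈; tri>)
open import Relation.Binary.PropositionalEquality
  using (_≢_; refl; sym; trans; cong; cong₂; subst; subst₂; module ≡-Reasoning)
import Relation.Binary.Reasoning.Base.Single as SingleRelationReasoning

open import Data.Nat using (zero; suc; pred; _+_; _*_; _∸_; _≤_; _<?_; z≤n; s≤s; s≤s⁻¹; z<s; NonZero; >-nonZero)
open import Data.Nat.Properties
open import Data.Nat.DivMod
  using (_/_; _%_; m≡m%n+[m/n]*n; m%n<n; m%n%n≡m%n; [m+kn]%n≡m%n; m<n⇒m%n≡m; m<n⇒m/n≡0; m*n/n≡m;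
         /-monoˡ-≤; +-distrib-/-∣ʳ; m<n*o⇒m/o<n)
open import Data.Nat.Divisibility using (divides)
open import Data.Nat.Induction using (<-rec)
open import Data.Nat.Tactic.RingSolver using (solve-∀)

open import Data.List using ([]; _∷_; length; lookup)
open import Data.List.Membership.Propositional.Properties using (∈-lookup)
open import Data.List.Relation.Unary.All as All using ([]; _∷_)
open import Data.Vec.Base using (_∷_; here; there)
open import Data.Fin as Fin using (Fin; toℕ; fromℕ; fromℕ<; inject₁; punchOut)
open import Data.Fin.Properties
  using (toℕ<n; toℕ-fromℕ<; toℕ-inject₁; toℕ-injective; fromℕ<-injective; any?; punchOut-injective; injective⇒≤)
  renaming (_≟_ to _≟ᶠ_)
open import Data.Fin.Subset using (Subset; _∈_; _∉_; _⊆_; ∣_∣; ⁅_⁆; _∪_; inside; outside)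
open import Data.Fin.Subset.Properties
  using (_∈?_; ∣⁅x⁆∣≡1; x∈⁅y⁆⇒x≡y; x∈⁅x⁆; x∈p∪q⁻; x∈p∪q⁺; ∣p∣≡n⇒p≡⊤; ∈⊤; ∪-identityʳ; p⊆q⇒∣p∣≤∣q∣)

open import Algebra.Bundles using (AbelianGroup)
open import Algebra.Structures using (IsAbelianGroup)
import Algebra.Properties.AbelianGroup as AbelianGroupProperties
import Algebra.Properties.CommutativeSemigroup as CommutativeSemigroupProperties

-- Mixed radix digits

module _ (d : ℕ) .{{_ : NonZero d}} where

  digits : ∀ a → a ≡ a % d + d * (a / d)
  digits a = trans (m≡m%n+[m/n]*n a d) (cong (a % d +_) (*-comm (a / d) d))

  %-digits : ∀ {x} y → x < d → (x + d * y) % d ≡ x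
  %-digits {x} y x<d = trans (cong (λ z → (x + z) % d) (*-comm d y)) (trans ([m+kn]%n≡m%n x y d) (m<n⇒m%n≡m x<d))

  /-digits : ∀ {x} y → x < d → (x + d * y) / d ≡ y
  /-digits {x} y x<d = trans (+-distrib-/-∣ʳ x (divides y (*-comm d y)))
    (cong₂ _+_ (m<n⇒m/n≡0 x<d) (trans (cong (_/ d) (*-comm d y)) (m*n/n≡m y d)))

  digits-< : ∀ {x y U} → x < d → y < U → x + d * y < d * U
  digits-< {x} {y} {U} x<d y<U = begin-strict
    x + d * y <⟨ +-monoˡ-< (d * y) x<d ⟩
    d + d * y ≡⟨ *-suc d y ⟨
    d * suc y ≤⟨ *-monoʳ-≤ d y<U ⟩
    d * U     ∎
    where open ≤-Reasoning

  /-< : ∀ {a} P → a < d * P → a / d < P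
  /-< {a} P a<dP = m<n*o⇒m/o<n (subst (a <_) (*-comm d P) a<dP)

  ≤-digits : ∀ {x y i} → x ≤ i % d → y ≤ i / d → x + d * y ≤ i
  ≤-digits {x} {y} {i} x≤ y≤ = subst (x + d * y ≤_) (sym (digits i)) (+-mono-≤ x≤ (*-monoʳ-≤ d y≤))

  <-digits-high : ∀ {x y i} → x < d → y < i / d → x + d * y < i
  <-digits-high {i = i} x<d y< =
    <-≤-trans (digits-< x<d y<) (subst (d * (i / d) ≤_) (sym (digits i)) (m≤n+m _ (i % d)))

  <-digits-low : ∀ {x i} → x < i % d → x + d * (i / d) < i
  <-digits-low {x} {i} x< = subst (x + d * (i / d) <_) (sym (digits i)) (+-monoˡ-< (d * (i / d)) x<)

  same-/⇒%-mono-≤ : ∀ {a i} → a ≤ i → a / d ≡ i / d → a % d ≤ i % d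
  same-/⇒%-mono-≤ {a} {i} a≤i eq = +-cancelʳ-≤ (d * (i / d)) (a % d) (i % d)
    (subst₂ _≤_ (trans (digits a) (cong (λ z → a % d + d * z) eq)) (digits i) a≤i)

  same-/⇒%-mono-< : ∀ {a i} → a < i → a / d ≡ i / d → a % d < i % d
  same-/⇒%-mono-< {a} {i} a<i eq = +-cancelʳ-< (d * (i / d)) (a % d) (i % d)
    (subst₂ _<_ (trans (digits a) (cong (λ z → a % d + d * z) eq)) (digits i) a<i)

  /-below-or-same : ∀ {a b i j} → a ≤ i → b ≤ j →
                    (a / d < i / d ⊎ b / d < j / d) ⊎ (a / d ≡ i / d × b / d ≡ j / d)
  /-below-or-same a≤i b≤j with m≤n⇒m<n∨m≡n (/-monoˡ-≤ d a≤i) | m≤n⇒m<n∨m≡n (/-monoˡ-≤ d b≤j)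
  ... | inj₁ a/<i/ | _          = inj₁ (inj₁ a/<i/)
  ... | inj₂ _     | inj₁ b/<j/ = inj₁ (inj₂ b/<j/)
  ... | inj₂ a/≡i/ | inj₂ b/≡j/ = inj₂ (a/≡i/ , b/≡j/)

pred-+ : ∀ {a} b → 0 < a → pred (a + b) ≡ pred a + b
pred-+ {suc a} b _ = refl

%-complement : ∀ m u → ∃ λ a → a < suc m × (a + u) % suc m ≡ m
%-complement m u = m ∸ u % suc m , s≤s (m∸n≤m m (u % suc m)) , sum≡m
  where
  open ≡-Reasoning
  sum≡m : (m ∸ u % suc m + u) % suc m ≡ m
  sum≡m = begin
    (m ∸ u % suc m + u) % suc m
      ≡⟨ cong (λ z → (m ∸ u % suc m + z) % suc m) (digits (suc m) u) ⟩
    (m ∸ u % suc m + (u % suc m + suc m * (u / suc m))) % suc m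
      ≡⟨ cong (_% suc m) (+-assoc (m ∸ u % suc m) (u % suc m) _) ⟨
    (m ∸ u % suc m + u % suc m + suc m * (u / suc m)) % suc m
      ≡⟨ cong (λ z → (z + suc m * (u / suc m)) % suc m) (m∸n+n≡m (s≤s⁻¹ (m%n<n u (suc m)))) ⟩
    (m + suc m * (u / suc m)) % suc m
      ≡⟨ %-digits (suc m) (u / suc m) ≤-refl ⟩
    m ∎

-- Twisted additions

-- The clauses for a radix 0 are junk: every nₛ is > 1.
CarryFree : List ℕ → ℕ → ℕ → Set
CarryFree []           i j = ⊤
CarryFree (zero  ∷ ms) i j = ⊤
CarryFree (suc m ∷ ms) i j = i % suc m + j % suc m < suc m × CarryFree ms (i / suc m) (j / suc m)

carryFree? : ∀ ns i j → Dec (CarryFree ns i j)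
carryFree? []           i j = yes tt
carryFree? (zero  ∷ ms) i j = yes tt
carryFree? (suc m ∷ ms) i j = (i % suc m + j % suc m <? suc m) ×-dec carryFree? ms (i / suc m) (j / suc m)

-- A twisted addition adds digitwise, except that the lowest digit also receives a twist u a′ b′ from
-- the higher parts a′, b′ of the arguments, which vanishes whenever a′ + b′ is carry free. T(𝔗) and
-- the multiplication of G in the coordinates given by a filtration are both twisted additions.
TwistStep : ℕ → List ℕ → (f f′ u : ℕ → ℕ → ℕ) → Set
TwistStep m ms f f′ u = ∀ a b → a < suc m * product ms → b < suc m * product ms →
  f a b ≡ (a % suc m + b % suc m + u (a / suc m) (b / suc m)) % suc m + suc m * f′ (a / suc m) (b / suc m)

data TwistedAddition : List ℕ → (ℕ → ℕ → ℕ) → Set where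
  twist-[] : ∀ {f} → f 0 0 ≡ 0 → TwistedAddition [] f
  twist-∷  : ∀ {m ms f} (f′ u : ℕ → ℕ → ℕ) → TwistedAddition ms f′ →
             (∀ a b → a < product ms → b < product ms → CarryFree ms a b → u a b ≡ 0) →
             TwistStep m ms f f′ u → TwistedAddition (suc m ∷ ms) f

twistStep-digits : ∀ {m ms f f′ u} → TwistStep m ms f f′ u → ∀ {x y a b} → x < suc m → y < suc m →
                   a < product ms → b < product ms →
                   f (x + suc m * a) (y + suc m * b) ≡ (x + y + u a b) % suc m + suc m * f′ a b
twistStep-digits {m} {ms} {f} {f′} {u} f≡ {x} {y} {a} {b} x< y< a< b<
  rewrite f≡ (x + suc m * a) (y + suc m * b) (digits-< (suc m) x< a<) (digits-< (suc m) y< b<)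
        | %-digits (suc m) a x< | %-digits (suc m) b y< | /-digits (suc m) a x< | /-digits (suc m) b y< = refl

-- The maximum of every twisted addition on the box [0, i] × [0, j].
boxMax : List ℕ → ℕ → ℕ → ℕ
boxMax []           i j = 0
boxMax (zero  ∷ ms) i j = 0
boxMax (suc m ∷ ms) i j with carryFree? (suc m ∷ ms) i j
... | yes _ = i % suc m + j % suc m + suc m * boxMax ms (i / suc m) (j / suc m)
... | no  _ = m + suc m * boxMax ms (i / suc m) (j / suc m)

module _ {m : ℕ} {ms : List ℕ} (i j : ℕ) where

  boxMax-carryFree : CarryFree (suc m ∷ ms) i j →
    boxMax (suc m ∷ ms) i j ≡ i % suc m + j % suc m + suc m * boxMax ms (i / suc m) (j / suc m)
  boxMax-carryFree c with carryFree? (suc m ∷ ms) i j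
  ... | yes _ = refl
  ... | no ¬c = ⊥-elim (¬c c)

  boxMax-carry : ¬ CarryFree (suc m ∷ ms) i j → boxMax (suc m ∷ ms) i j ≡ m + suc m * boxMax ms (i / suc m) (j / suc m)
  boxMax-carry ¬c with carryFree? (suc m ∷ ms) i j
  ... | yes c = ⊥-elim (¬c c)
  ... | no _  = refl

twisted-carryFree : ∀ {ns f} → TwistedAddition ns f → ∀ {i j} → i < product ns → j < product ns →
                    CarryFree ns i j → f i j ≡ boxMax ns i j
twisted-carryFree (twist-[] f00≡0) {0} {0} _ _ _ = f00≡0
twisted-carryFree (twist-[] _) {0} {suc _} _ (s≤s ()) _
twisted-carryFree (twist-[] _) {suc _} (s≤s ()) _ _
twisted-carryFree {suc m ∷ ms} {f} (twist-∷ f′ u tw′ u≡0 f≡) {i} {j} i< j< c@(low< , c′) = begin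
  f i j
    ≡⟨ f≡ i j i< j< ⟩
  (i % suc m + j % suc m + u i′ j′) % suc m + suc m * f′ i′ j′
    ≡⟨ cong₂ (λ x y → (i % suc m + j % suc m + x) % suc m + suc m * y)
             (u≡0 i′ j′ i′< j′< c′) (twisted-carryFree tw′ i′< j′< c′) ⟩
  (i % suc m + j % suc m + 0) % suc m + suc m * boxMax ms i′ j′
    ≡⟨ cong (λ x → x % suc m + suc m * boxMax ms i′ j′) (+-identityʳ (i % suc m + j % suc m)) ⟩
  (i % suc m + j % suc m) % suc m + suc m * boxMax ms i′ j′
    ≡⟨ cong (_+ suc m * boxMax ms i′ j′) (m<n⇒m%n≡m low<) ⟩
  i % suc m + j % suc m + suc m * boxMax ms i′ j′
    ≡⟨ boxMax-carryFree i j c ⟨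
  boxMax (suc m ∷ ms) i j ∎
  where
  open ≡-Reasoning
  i′ = i / suc m
  j′ = j / suc m
  i′< : i′ < product ms
  i′< = /-< (suc m) (product ms) i<
  j′< : j′ < product ms
  j′< = /-< (suc m) (product ms) j<

twisted-at-corner : ∀ {m ms f} → TwistedAddition (suc m ∷ ms) f → ∀ {i j a b} →
  a < suc m * product ms → b < suc m * product ms → a / suc m ≡ i / suc m → b / suc m ≡ j / suc m →
  CarryFree ms (i / suc m) (j / suc m) → a % suc m + b % suc m < suc m →
  f a b ≡ a % suc m + b % suc m + suc m * boxMax ms (i / suc m) (j / suc m)
twisted-at-corner {m} {ms} {f} tw {i} {j} {a} {b} a< b< a/≡i/ b/≡j/ c′ low< = begin
  f a b                                              ≡⟨ twisted-carryFree tw a< b< cab ⟩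
  boxMax (suc m ∷ ms) a b                            ≡⟨ boxMax-carryFree a b cab ⟩
  a % suc m + b % suc m + suc m * boxMax ms (a / suc m) (b / suc m)
    ≡⟨ cong₂ (λ x y → a % suc m + b % suc m + suc m * boxMax ms x y) a/≡i/ b/≡j/ ⟩
  a % suc m + b % suc m + suc m * boxMax ms (i / suc m) (j / suc m) ∎
  where
  open ≡-Reasoning
  cab : CarryFree (suc m ∷ ms) a b
  cab = low< , subst₂ (CarryFree ms) (sym a/≡i/) (sym b/≡j/) c′

twisted-<-boxMax : ∀ {ns f} → TwistedAddition ns f → ∀ {i j a b} → i < product ns → j < product ns →
                   CarryFree ns i j → a ≤ i → b ≤ j → a < i ⊎ b < j → f a b < boxMax ns i j
twisted-below-corner : ∀ {m ms f} → TwistedAddition (suc m ∷ ms) f → ∀ {i j a b} →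
  i < suc m * product ms → j < suc m * product ms → CarryFree ms (i / suc m) (j / suc m) → a ≤ i → b ≤ j →
  a / suc m < i / suc m ⊎ b / suc m < j / suc m → f a b < suc m * boxMax ms (i / suc m) (j / suc m)

twisted-<-boxMax (twist-[] _) {0} {0} _ _ _ z≤n z≤n (inj₁ ())
twisted-<-boxMax (twist-[] _) {0} {0} _ _ _ z≤n z≤n (inj₂ ())
twisted-<-boxMax (twist-[] _) {0} {suc _} _ (s≤s ()) _ _ _ _
twisted-<-boxMax (twist-[] _) {suc _} (s≤s ()) _ _ _ _ _
twisted-<-boxMax {suc m ∷ ms} {f} tw {i} {j} {a} {b} i< j< c@(low< , c′) a≤i b≤j a<i⊎b<j =
  subst (f a b <_) (sym (boxMax-carryFree i j c)) (cases (/-below-or-same (suc m) a≤i b≤j))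
  where
  V′ = boxMax ms (i / suc m) (j / suc m)
  cases : (a / suc m < i / suc m ⊎ b / suc m < j / suc m) ⊎ (a / suc m ≡ i / suc m × b / suc m ≡ j / suc m) →
          f a b < i % suc m + j % suc m + suc m * V′
  cases (inj₁ below) = <-≤-trans (twisted-below-corner tw i< j< c′ a≤i b≤j below) (m≤n+m (suc m * V′) (i % suc m + j % suc m))
  cases (inj₂ (a/≡i/ , b/≡j/)) =
    subst (_< i % suc m + j % suc m + suc m * V′)
          (sym (twisted-at-corner tw {i} {j} (≤-<-trans a≤i i<) (≤-<-trans b≤j j<) a/≡i/ b/≡j/ c′ (<-trans low<low low<)))
          (+-monoˡ-< (suc m * V′) low<low)
    where
    low<low : a % suc m + b % suc m < i % suc m + j % suc m
    low<low = [ (λ a<i → +-mono-<-≤ (same-/⇒%-mono-< (suc m) a<i a/≡i/) (same-/⇒%-mono-≤ (suc m) b≤j b/≡j/))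
              , (λ b<j → +-mono-≤-< (same-/⇒%-mono-≤ (suc m) a≤i a/≡i/) (same-/⇒%-mono-< (suc m) b<j b/≡j/)) ]′ a<i⊎b<j

twisted-below-corner {m} {ms} {f} (twist-∷ f′ u tw′ _ f≡) {i} {j} {a} {b} i< j< c′ a≤i b≤j below = begin-strict
  f a b
    ≡⟨ f≡ a b (≤-<-trans a≤i i<) (≤-<-trans b≤j j<) ⟩
  (a % suc m + b % suc m + u (a / suc m) (b / suc m)) % suc m + suc m * f′ (a / suc m) (b / suc m)
    <⟨ digits-< (suc m) (m%n<n (a % suc m + b % suc m + u (a / suc m) (b / suc m)) (suc m))
                (twisted-<-boxMax tw′ (/-< (suc m) _ i<) (/-< (suc m) _ j<) c′
                                  (/-monoˡ-≤ (suc m) a≤i) (/-monoˡ-≤ (suc m) b≤j) below) ⟩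
  suc m * boxMax ms (i / suc m) (j / suc m) ∎
  where open ≤-Reasoning

twisted-≤-boxMax-carryFree : ∀ {ns f} → TwistedAddition ns f → ∀ {i j a b} → i < product ns → j < product ns →
                             CarryFree ns i j → a ≤ i → b ≤ j → f a b ≤ boxMax ns i j
twisted-≤-boxMax-carryFree tw i< j< c a≤i b≤j with m≤n⇒m<n∨m≡n a≤i | m≤n⇒m<n∨m≡n b≤j
... | inj₁ a<i  | _         = <⇒≤ (twisted-<-boxMax tw i< j< c a≤i b≤j (inj₁ a<i))
... | inj₂ _    | inj₁ b<j  = <⇒≤ (twisted-<-boxMax tw i< j< c a≤i b≤j (inj₂ b<j))
... | inj₂ refl | inj₂ refl = ≤-reflexive (twisted-carryFree tw i< j< c)

twisted-≤-boxMax : ∀ {ns f} → TwistedAddition ns f → ∀ {i j a b} → i < product ns → j < product ns →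
                   a ≤ i → b ≤ j → f a b ≤ boxMax ns i j
twisted-≤-boxMax {ns} tw {i} {j} i< j< a≤i b≤j with carryFree? ns i j
... | yes c = twisted-≤-boxMax-carryFree tw i< j< c a≤i b≤j
twisted-≤-boxMax (twist-[] _) _ _ _ _ | no ¬c = ⊥-elim (¬c tt)
twisted-≤-boxMax {suc m ∷ ms} {f} (twist-∷ f′ u tw′ _ f≡) {i} {j} {a} {b} i< j< a≤i b≤j | no ¬c = begin
  f a b
    ≡⟨ f≡ a b (≤-<-trans a≤i i<) (≤-<-trans b≤j j<) ⟩
  (a % suc m + b % suc m + u (a / suc m) (b / suc m)) % suc m + suc m * f′ (a / suc m) (b / suc m)
    ≤⟨ +-mono-≤ (s≤s⁻¹ (m%n<n (a % suc m + b % suc m + u (a / suc m) (b / suc m)) (suc m)))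
                (*-monoʳ-≤ (suc m) (twisted-≤-boxMax tw′ (/-< (suc m) _ i<) (/-< (suc m) _ j<)
                                                      (/-monoˡ-≤ (suc m) a≤i) (/-monoˡ-≤ (suc m) b≤j))) ⟩
  m + suc m * boxMax ms (i / suc m) (j / suc m)
    ≡⟨ boxMax-carry i j ¬c ⟨
  boxMax (suc m ∷ ms) i j ∎
  where open ≤-Reasoning

AttainedOffCorner : (ℕ → ℕ → ℕ) → ℕ → ℕ → ℕ → Set
AttainedOffCorner f i j v = ∃₂ λ a b → a ≤ i × b ≤ j × (a < i ⊎ b < j) × f a b ≡ v

module CarryWitnesses {m : ℕ} {ms : List ℕ} {f f′ u : ℕ → ℕ → ℕ} (f≡ : TwistStep m ms f f′ u)
                      {i j : ℕ} (i< : i < suc m * product ms) (j< : j < suc m * product ms) where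

  private
    M = suc m
    P = product ms
    i′ = i / M
    j′ = j / M
    i′< : i′ < P
    i′< = /-< M P i<
    j′< : j′ < P
    j′< = /-< M P j<

    top-digit : ∀ {x y a b} → x < M → y < M → a < P → b < P → (x + y + u a b) % M ≡ m →
                f (x + M * a) (y + M * b) ≡ m + M * f′ a b
    top-digit x< y< a< b< top = trans (twistStep-digits {ms = ms} {f} {f′} {u} f≡ x< y< a< b<) (cong (_+ M * f′ _ _) top)

  -- keep the higher parts and choose the lowest digit so that it becomes m
  high-carry : ∀ {v} → AttainedOffCorner f′ i′ j′ v → AttainedOffCorner f i j (m + M * v)
  high-carry (a′ , b′ , a′≤ , b′≤ , inj₁ a′<i′ , f′≡) with %-complement m (u a′ b′)
  ... | x , x< , top =
    x + M * a′ , 0 + M * b′ , <⇒≤ (<-digits-high M x< a′<i′) , ≤-digits M z≤n b′≤ , inj₁ (<-digits-high M x< a′<i′) ,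
    trans (top-digit x< z<s (<-trans a′<i′ i′<) (≤-<-trans b′≤ j′<) (trans (cong (λ z → (z + u a′ b′) % M) (+-identityʳ x)) top))
          (cong (λ z → m + M * z) f′≡)
  high-carry (a′ , b′ , a′≤ , b′≤ , inj₂ b′<j′ , f′≡) with %-complement m (u a′ b′)
  ... | y , y< , top =
    0 + M * a′ , y + M * b′ , ≤-digits M z≤n a′≤ , <⇒≤ (<-digits-high M y< b′<j′) , inj₂ (<-digits-high M y< b′<j′) ,
    trans (top-digit z<s y< (≤-<-trans a′≤ i′<) (<-trans b′<j′ j′<) top) (cong (λ z → m + M * z) f′≡)

  -- the lowest digits overflow: lower the digit of i to m ∸ j % M
  low-carry : u i′ j′ ≡ 0 → ¬ (i % M + j % M < M) → AttainedOffCorner f i j (m + M * f′ i′ j′)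
  low-carry u≡0 overflow = x + M * i′ , j % M + M * j′ , <⇒≤ (<-digits-low M x<i%) , ≤-reflexive (sym (digits M j)) ,
                           inj₁ (<-digits-low M x<i%) , top-digit x< (m%n<n j M) i′< j′< top
    where
    j%≤m : j % M ≤ m
    j%≤m = s≤s⁻¹ (m%n<n j M)
    x = m ∸ j % M
    x< : x < M
    x< = s≤s (m∸n≤m m (j % M))
    x<i% : x < i % M
    x<i% = +-cancelʳ-< (j % M) x (i % M) (subst (_< i % M + j % M) (sym (m∸n+n≡m j%≤m)) (≮⇒≥ overflow))
    top : (x + j % M + u i′ j′) % M ≡ m
    top = trans (cong₂ (λ z w → (z + w) % M) (m∸n+n≡m j%≤m) u≡0) (trans (cong (_% M) (+-identityʳ m)) (m<n⇒m%n≡m ≤-refl))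

twisted-attains-carry : ∀ {ns f} → TwistedAddition ns f → ∀ {i j} → i < product ns → j < product ns →
                        ¬ CarryFree ns i j → AttainedOffCorner f i j (boxMax ns i j)
twisted-attains-carry (twist-[] _) _ _ ¬c = ⊥-elim (¬c tt)
twisted-attains-carry {suc m ∷ ms} {f} (twist-∷ f′ u tw′ u≡0 f≡) {i} {j} i< j< ¬c =
  subst (AttainedOffCorner f i j) (sym (boxMax-carry i j ¬c)) (cases (carryFree? ms i′ j′))
  where
  open CarryWitnesses {m} {ms} {f} {f′} {u} f≡ i< j<
  i′ = i / suc m
  j′ = j / suc m
  i′< : i′ < product ms
  i′< = /-< (suc m) (product ms) i<
  j′< : j′ < product ms
  j′< = /-< (suc m) (product ms) j<
  cases : Dec (CarryFree ms i′ j′) → AttainedOffCorner f i j (m + suc m * boxMax ms i′ j′)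
  cases (yes c′) = subst (λ v → AttainedOffCorner f i j (m + suc m * v)) (twisted-carryFree tw′ i′< j′< c′)
                         (low-carry (u≡0 i′ j′ i′< j′< c′) (λ low< → ¬c (low< , c′)))
  cases (no ¬c′) = high-carry (twisted-attains-carry tw′ i′< j′< ¬c′)

twisted-attains-boxMax : ∀ {ns f} → TwistedAddition ns f → ∀ {i j} → i < product ns → j < product ns →
                         ∃₂ λ a b → a ≤ i × b ≤ j × f a b ≡ boxMax ns i j
twisted-attains-boxMax {ns} tw {i} {j} i< j< with carryFree? ns i j
... | yes c = i , j , ≤-refl , ≤-refl , twisted-carryFree tw i< j< c
... | no ¬c with twisted-attains-carry tw i< j< ¬c
...   | a , b , a≤i , b≤j , _ , fab≡ = a , b , a≤i , b≤j , fab≡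

twisted-box-bound⇔ : ∀ {ns f} → TwistedAddition ns f → ∀ {i j} → i < product ns → j < product ns → ∀ k →
                     (∀ a b → a ≤ i → b ≤ j → f a b ≤ k) ⇔ boxMax ns i j ≤ k
twisted-box-bound⇔ {ns} {f} tw {i} {j} i< j< k =
  mk⇔ attained-bound (λ V≤k a b a≤i b≤j → ≤-trans (twisted-≤-boxMax tw i< j< a≤i b≤j) V≤k)
  where
  attained-bound : (∀ a b → a ≤ i → b ≤ j → f a b ≤ k) → boxMax ns i j ≤ k
  attained-bound bound with twisted-attains-boxMax tw i< j<
  ... | a , b , a≤i , b≤j , fab≡ = subst (_≤ k) fab≡ (bound a b a≤i b≤j)

-- The tower operation

-- place s ns = n₁ ⋯ nₛ is the place value of the digit iₛ₊₁ in mixed radix notation.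
place : ℕ → List ℕ → ℕ
place zero    _        = 1
place (suc s) []       = 1
place (suc s) (m ∷ ms) = m * place s ms

place-length : ∀ ns → place (length ns) ns ≡ product ns
place-length []       = refl
place-length (m ∷ ms) = cong (m *_) (place-length ms)

place-suc : ∀ ns (s : Fin (length ns)) → place (suc (toℕ s)) ns ≡ place (toℕ s) ns * lookup ns s
place-suc (m ∷ ms) Fin.zero    = trans (*-identityʳ m) (sym (+-identityʳ m))
place-suc (m ∷ ms) (Fin.suc s) = trans (cong (m *_) (place-suc ms s)) (sym (*-assoc m (place (toℕ s) ms) (lookup ms s)))

place-positive : ∀ {ns} → All (1 <_) ns → ∀ s → 1 ≤ place s ns
place-positive _                zero    = ≤-refl
place-positive []               (suc s) = ≤-refl
place-positive (m>1 ∷ ms>1) (suc s) = *-mono-≤ (<⇒≤ m>1) (place-positive ms>1 s)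

place-mono-suc : ∀ {ns} → All (1 <_) ns → ∀ s → place s ns ≤ place (suc s) ns
place-mono-suc []                       zero    = ≤-refl
place-mono-suc []                       (suc s) = ≤-refl
place-mono-suc {m ∷ _} (m>1 ∷ _)    zero    = ≤-trans (<⇒≤ m>1) (≤-reflexive (sym (*-identityʳ m)))
place-mono-suc {m ∷ _} (_ ∷ ms>1)   (suc s) = *-monoʳ-≤ m (place-mono-suc ms>1 s)

place≤product : ∀ {ns} → All (1 <_) ns → ∀ s → s ≤ length ns → place s ns ≤ product ns
place≤product {ns}     ns>1         zero    _  = subst (1 ≤_) (place-length ns) (place-positive ns>1 (length ns))
place≤product {m ∷ _} (_ ∷ ms>1)  (suc s) s≤ = *-monoʳ-≤ m (place≤product ms>1 s (s≤s⁻¹ s≤))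

addMR-0-0 : ∀ ns → addMR ns 0 0 ≡ 0
addMR-0-0 []           = refl
addMR-0-0 (zero  ∷ ms) = refl
addMR-0-0 (suc m ∷ ms) = trans (cong (suc m *_) (addMR-0-0 ms)) (*-zeroʳ (suc m))

addMR-identityʳ : ∀ ns {a} → a < product ns → addMR ns a 0 ≡ a
addMR-identityʳ []           {zero}  _         = refl
addMR-identityʳ []           {suc _} (s≤s ())
addMR-identityʳ (suc m ∷ ms) {a}  a< = begin
  (a % suc m + 0 % suc m) % suc m + suc m * addMR ms (a / suc m) 0
    ≡⟨ cong₂ (λ x y → x + suc m * y)
             (trans (cong (_% suc m) (+-identityʳ (a % suc m))) (m%n%n≡m%n a (suc m)))
             (addMR-identityʳ ms (/-< (suc m) (product ms) a<)) ⟩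
  a % suc m + suc m * (a / suc m)
    ≡⟨ digits (suc m) a ⟨
  a ∎
  where open ≡-Reasoning

addMR-place< : ∀ s ns {a b} → a < place s ns → b < place s ns → addMR ns a b < place s ns
addMR-place< zero    ns           {zero}  {zero}  _        _        = subst (_< 1) (sym (addMR-0-0 ns)) ≤-refl
addMR-place< zero    ns           {suc _}         (s≤s ()) _
addMR-place< zero    ns           {zero}  {suc _} _        (s≤s ())
addMR-place< (suc s) []           _  _  = ≤-refl
addMR-place< (suc s) (suc m ∷ ms) {a} {b} a< b< =
  digits-< (suc m) (m%n<n (a % suc m + b % suc m) (suc m))
           (addMR-place< s ms (/-< (suc m) (place s ms) a<) (/-< (suc m) (place s ms) b<))

addMR-no-carry : ∀ m ms x y → x + y < suc m → addMR (suc m ∷ ms) x y ≡ x + y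
addMR-no-carry m ms x y xy< = begin
  (x % suc m + y % suc m) % suc m + suc m * addMR ms (x / suc m) (y / suc m)
    ≡⟨ cong₂ (λ u v → (u + v) % suc m + suc m * addMR ms (x / suc m) (y / suc m)) (m<n⇒m%n≡m x<) (m<n⇒m%n≡m y<) ⟩
  (x + y) % suc m + suc m * addMR ms (x / suc m) (y / suc m)
    ≡⟨ cong₂ (λ u v → (x + y) % suc m + suc m * addMR ms u v) (m<n⇒m/n≡0 x<) (m<n⇒m/n≡0 y<) ⟩
  (x + y) % suc m + suc m * addMR ms 0 0
    ≡⟨ cong₂ (λ u v → u + suc m * v) (m<n⇒m%n≡m xy<) (addMR-0-0 ms) ⟩
  x + y + suc m * 0
    ≡⟨ cong (x + y +_) (*-zeroʳ (suc m)) ⟩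
  x + y + 0
    ≡⟨ +-identityʳ (x + y) ⟩
  x + y ∎
  where
  open ≡-Reasoning
  x< = ≤-<-trans (m≤m+n x y) xy<
  y< = ≤-<-trans (m≤n+m y x) xy<

addMR-box : ∀ ns (s : Fin (length ns)) {x y a b} → x + y < lookup ns s →
            a < place (toℕ s) ns * suc x → b < place (toℕ s) ns * suc y →
            addMR ns a b < place (toℕ s) ns * suc (x + y)
addMR-box (suc m ∷ ms) Fin.zero {x} {y} {a} {b} xy< a< b< = begin-strict
  addMR (suc m ∷ ms) a b ≡⟨ addMR-no-carry m ms a b (≤-<-trans (+-mono-≤ a≤x b≤y) xy<) ⟩
  a + b                  <⟨ s≤s (+-mono-≤ a≤x b≤y) ⟩
  suc (x + y)            ≡⟨ *-identityˡ (suc (x + y)) ⟨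
  1 * suc (x + y)        ∎
  where
  open ≤-Reasoning
  a≤x : a ≤ x
  a≤x = s≤s⁻¹ (subst (a <_) (*-identityˡ (suc x)) a<)
  b≤y : b ≤ y
  b≤y = s≤s⁻¹ (subst (b <_) (*-identityˡ (suc y)) b<)
addMR-box (zero ∷ ms) (Fin.suc s) {x} {a = a} _ a< _ = ⊥-elim (n≮0 (subst (a <_) (*-zeroˡ (suc x)) a<))
addMR-box (suc m ∷ ms) (Fin.suc s) {x} {y} {a} {b} xy< a< b< =
  subst (addMR (suc m ∷ ms) a b <_) (sym (*-assoc (suc m) P (suc (x + y))))
    (digits-< (suc m) (m%n<n (a % suc m + b % suc m) (suc m))
      (addMR-box ms s xy< (/-< (suc m) _ (subst (a <_) (*-assoc (suc m) P (suc x)) a<))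
                       (/-< (suc m) _ (subst (b <_) (*-assoc (suc m) P (suc y)) b<))))
  where P = place (toℕ s) ms

addMR-exact : ∀ ns (s : Fin (length ns)) {x y r} → x + y < lookup ns s → r < place (toℕ s) ns →
              addMR ns (place (toℕ s) ns * x) (r + place (toℕ s) ns * y) ≡ r + place (toℕ s) ns * (x + y)
addMR-exact (suc m ∷ ms) Fin.zero {x} {y} {zero} xy< _ = begin
  addMR (suc m ∷ ms) (1 * x) (1 * y) ≡⟨ cong₂ (addMR (suc m ∷ ms)) (*-identityˡ x) (*-identityˡ y) ⟩
  addMR (suc m ∷ ms) x y             ≡⟨ addMR-no-carry m ms x y xy< ⟩
  x + y                              ≡⟨ *-identityˡ (x + y) ⟨
  1 * (x + y)                        ∎
  where open ≡-Reasoning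
addMR-exact (suc m ∷ ms) Fin.zero {r = suc _} _ (s≤s ())
addMR-exact (suc m ∷ ms) (Fin.suc s) {x} {y} {r} xy< r< = begin
  addMR ns ((suc m * P) * x) (r + (suc m * P) * y)
    ≡⟨ cong₂ (addMR ns) (*-assoc (suc m) P x) (trans (cong (_+ (suc m * P) * y) (digits (suc m) r)) (regroup r₀ r₁ y)) ⟩
  addMR ns (0 + suc m * (P * x)) (r₀ + suc m * (r₁ + P * y))
    ≡⟨ cong₂ (λ u v → (u + v) % suc m + suc m * addMR ms (0 + suc m * (P * x) / suc m) ((r₀ + suc m * (r₁ + P * y)) / suc m))
             (%-digits (suc m) (P * x) z<s) (%-digits (suc m) (r₁ + P * y) r₀<) ⟩
  r₀ % suc m + suc m * addMR ms ((0 + suc m * (P * x)) / suc m) ((r₀ + suc m * (r₁ + P * y)) / suc m)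
    ≡⟨ cong₂ (λ u v → r₀ % suc m + suc m * addMR ms u v) (/-digits (suc m) (P * x) z<s) (/-digits (suc m) (r₁ + P * y) r₀<) ⟩
  r₀ % suc m + suc m * addMR ms (P * x) (r₁ + P * y)
    ≡⟨ cong₂ (λ u v → u + suc m * v) (m%n%n≡m%n r (suc m)) (addMR-exact ms s xy< (/-< (suc m) P r<)) ⟩
  r₀ + suc m * (r₁ + P * (x + y))
    ≡⟨ trans (cong (_+ (suc m * P) * (x + y)) (digits (suc m) r)) (regroup r₀ r₁ (x + y)) ⟨
  r + (suc m * P) * (x + y) ∎
  where
  open ≡-Reasoning
  ns = suc m ∷ ms
  P = place (toℕ s) ms
  r₀ = r % suc m
  r₁ = r / suc m
  r₀< : r₀ < suc m
  r₀< = m%n<n r (suc m)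
  regroup : ∀ u v w → (u + suc m * v) + (suc m * P) * w ≡ u + suc m * (v + P * w)
  regroup u v w = regroup-ring u (suc m) v P w
    where
    regroup-ring : ∀ u M v P w → (u + M * v) + (M * P) * w ≡ u + M * (v + P * w)
    regroup-ring = solve-∀

addMR-twisted : ∀ {ns} → All (1 <_) ns → TwistedAddition ns (addMR ns)
addMR-twisted []                       = twist-[] refl
addMR-twisted {suc m ∷ ms} (_ ∷ ns>1) = twist-∷ (addMR ms) (λ _ _ → 0) (addMR-twisted ns>1) (λ _ _ _ _ _ → refl)
  (λ a b _ _ → cong (λ z → z % suc m + suc m * addMR ms (a / suc m) (b / suc m)) (sym (+-identityʳ (a % suc m + b % suc m))))

-- Congruence modulo a subgroup

module GroupFacts {n : ℕ} (G : FiniteAbelianGroup n) where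

  open FiniteAbelianGroup G public
  open IsAbelianGroup isAbelianGroup public using (assoc; comm; identityˡ; identityʳ; inverseˡ; inverseʳ)

  abelianGroup : AbelianGroup _ _
  abelianGroup = record { isAbelianGroup = isAbelianGroup }

  open AbelianGroupProperties abelianGroup public
    using (∙-cancelˡ; ⁻¹-involutive; ε⁻¹≈ε; x∙y⁻¹≈ε⇒x≈y; ⁻¹-∙-comm; xyx⁻¹≈y)
  open CommutativeSemigroupProperties (AbelianGroup.commutativeSemigroup abelianGroup) public
    using (interchange; x∙yz≈y∙xz)

  pow-+ : ∀ g a b → pow G g (a + b) ≡ pow G g a ∙ pow G g b
  pow-+ g zero    b = sym (identityˡ _)
  pow-+ g (suc a) b = trans (cong (g ∙_) (pow-+ g a b)) (sym (assoc _ _ _))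

  x∙y⁻¹∙y≡x : ∀ x y → (x ∙ y ⁻¹) ∙ y ≡ x
  x∙y⁻¹∙y≡x x y = trans (assoc x (y ⁻¹) y) (trans (cong (x ∙_) (inverseˡ y)) (identityʳ x))

  module Modulo (S : Subset n) (S-subgroup : IsSubgroup G S) where

    open IsSubgroup S-subgroup

    infix 4 _∼_
    _∼_ : Fin n → Fin n → Set
    x ∼ y = x ∙ y ⁻¹ ∈ S

    ∼-refl : ∀ {x} → x ∼ x
    ∼-refl {x} = subst (_∈ S) (sym (inverseʳ x)) ε-mem

    ∼-reflexive : ∀ {x y} → x ≡ y → x ∼ y
    ∼-reflexive refl = ∼-refl

    ∼-sym : ∀ {x y} → x ∼ y → y ∼ x
    ∼-sym {x} {y} x∼y = subst (_∈ S) inverse (⁻¹-mem _ x∼y)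
      where
      inverse : (x ∙ y ⁻¹) ⁻¹ ≡ y ∙ x ⁻¹
      inverse = trans (sym (⁻¹-∙-comm x (y ⁻¹))) (trans (cong (x ⁻¹ ∙_) (⁻¹-involutive y)) (comm _ _))

    ∙-∼ : ∀ {x y x′ y′} → x ∼ y → x′ ∼ y′ → x ∙ x′ ∼ y ∙ y′
    ∙-∼ {x} {y} {x′} {y′} x∼y x′∼y′ = subst (_∈ S) regroup (∙-mem _ _ x∼y x′∼y′)
      where
      regroup : (x ∙ y ⁻¹) ∙ (x′ ∙ y′ ⁻¹) ≡ (x ∙ x′) ∙ (y ∙ y′) ⁻¹
      regroup = trans (interchange x (y ⁻¹) x′ (y′ ⁻¹)) (cong ((x ∙ x′) ∙_) (⁻¹-∙-comm y y′))

    ∼-trans : ∀ {x y z} → x ∼ y → y ∼ z → x ∼ z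
    ∼-trans {x} {y} {z} x∼y y∼z = subst (_∈ S) cancel (∙-∼ x∼y y∼z)
      where
      cancel : (x ∙ y) ∙ (y ∙ z) ⁻¹ ≡ x ∙ z ⁻¹
      cancel = begin
        (x ∙ y) ∙ (y ∙ z) ⁻¹       ≡⟨ cong ((x ∙ y) ∙_) (⁻¹-∙-comm y z) ⟨
        (x ∙ y) ∙ (y ⁻¹ ∙ z ⁻¹)    ≡⟨ interchange x y (y ⁻¹) (z ⁻¹) ⟩
        (x ∙ y ⁻¹) ∙ (y ∙ z ⁻¹)    ≡⟨ cong (_∙ (y ∙ z ⁻¹)) (comm x (y ⁻¹)) ⟩
        (y ⁻¹ ∙ x) ∙ (y ∙ z ⁻¹)    ≡⟨ interchange (y ⁻¹) x y (z ⁻¹) ⟩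
        (y ⁻¹ ∙ y) ∙ (x ∙ z ⁻¹)    ≡⟨ cong (_∙ (x ∙ z ⁻¹)) (inverseˡ y) ⟩
        ε ∙ (x ∙ z ⁻¹)             ≡⟨ identityˡ _ ⟩
        x ∙ z ⁻¹                   ∎
        where open ≡-Reasoning

    ∼-cancelˡ : ∀ {x y x′ y′} → x ∙ x′ ∼ y ∙ y′ → x ∼ y → x′ ∼ y′
    ∼-cancelˡ {x} {y} {x′} {y′} xx′∼yy′ x∼y = subst (_∈ S) cancel (∼-trans xx′∼yy′ (∙-∼ (∼-sym x∼y) ∼-refl))
      where
      cancel : (x ∙ x′) ∙ (x ∙ y′) ⁻¹ ≡ x′ ∙ y′ ⁻¹
      cancel = begin
        (x ∙ x′) ∙ (x ∙ y′) ⁻¹       ≡⟨ cong ((x ∙ x′) ∙_) (⁻¹-∙-comm x y′) ⟨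
        (x ∙ x′) ∙ (x ⁻¹ ∙ y′ ⁻¹)    ≡⟨ interchange x x′ (x ⁻¹) (y′ ⁻¹) ⟩
        (x ∙ x ⁻¹) ∙ (x′ ∙ y′ ⁻¹)    ≡⟨ cong (_∙ (x′ ∙ y′ ⁻¹)) (inverseʳ x) ⟩
        ε ∙ (x′ ∙ y′ ⁻¹)             ≡⟨ identityˡ _ ⟩
        x′ ∙ y′ ⁻¹                   ∎
        where open ≡-Reasoning

    ∼-cancelʳ : ∀ {x y x′ y′} → x ∙ x′ ∼ y ∙ y′ → x′ ∼ y′ → x ∼ y
    ∼-cancelʳ {x} {y} {x′} {y′} xx′∼yy′ = ∼-cancelˡ (subst₂ _∼_ (comm x x′) (comm y y′) xx′∼yy′)

    ∈⇒∼ε : ∀ {x} → x ∈ S → x ∼ ε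
    ∈⇒∼ε {x} x∈S = subst (_∈ S) (sym (trans (cong (x ∙_) ε⁻¹≈ε) (identityʳ x))) x∈S

    ∼ε⇒∈ : ∀ {x} → x ∼ ε → x ∈ S
    ∼ε⇒∈ {x} x∼ε = subst (_∈ S) (trans (cong (x ∙_) ε⁻¹≈ε) (identityʳ x)) x∼ε

    ∈-∼ : ∀ {x y} → x ∈ S → y ∈ S → x ∼ y
    ∈-∼ x∈S y∈S = ∼-trans (∈⇒∼ε x∈S) (∼-sym (∈⇒∼ε y∈S))

    module ∼-Reasoning = SingleRelationReasoning _∼_ ∼-refl ∼-trans

    pow-∈ : ∀ {g} k → g ∈ S → pow G g k ∈ S
    pow-∈ zero    g∈S = ε-mem
    pow-∈ (suc k) g∈S = ∙-mem _ _ g∈S (pow-∈ k g∈S)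

-- Coordinates given by a cyclic series

module CyclicSeries {n : ℕ} (G : FiniteAbelianGroup n) where

  open GroupFacts G

  module CyclicQuotient {A B : Subset n} {m : ℕ} (B-subgroup : IsSubgroup G B) (A-subgroup : IsSubgroup G A)
                        (q : CyclicQuotientOfOrder G A B (suc m)) where

    open Modulo B B-subgroup

    g : Fin n
    g = proj₁ q

    g∈A : g ∈ A
    g∈A = proj₁ (proj₂ q)

    pow-surjective : ∀ x → x ∈ A → ∃ λ k → k < suc m × x ∼ pow G g k
    pow-surjective = proj₁ (proj₂ (proj₂ q))

    pow-injective : ∀ k l → k < suc m → l < suc m → pow G g k ∼ pow G g l → k ≡ l
    pow-injective = proj₂ (proj₂ (proj₂ q))

    -- gᴹ ∼ gᵏ for some k < M, and k > 0 would give g^(M − k) ∼ g⁰ with 0 < M − k < M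
    pow-order-∈ : pow G g (suc m) ∈ B
    pow-order-∈ with pow-surjective (pow G g (suc m)) (Modulo.pow-∈ A A-subgroup (suc m) g∈A)
    ... | zero  , _   , gᴹ∼ε = ∼ε⇒∈ gᴹ∼ε
    ... | suc k , k<M , gᴹ∼gᵏ =
      ⊥-elim (<-irrefl refl (subst (0 <_) (pow-injective _ 0 (s≤s (m∸n≤m m k)) z<s gᴹ⁻ᵏ∼ε) (m<n⇒0<n∸m k<M)))
      where
      gᴹ⁻ᵏ∼ε : pow G g (suc m ∸ suc k) ∼ pow G g 0
      gᴹ⁻ᵏ∼ε = ∼-cancelʳ (subst₂ _∼_ (trans (cong (pow G g) (sym (m∸n+n≡m (<⇒≤ k<M)))) (pow-+ g (suc m ∸ suc k) (suc k)))
                                       (sym (identityˡ _)) gᴹ∼gᵏ)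
                         ∼-refl

    pow-multiple : ∀ q → pow G g (suc m * q) ∼ ε
    pow-multiple zero    = subst (λ z → pow G g z ∼ ε) (sym (*-zeroʳ (suc m))) ∼-refl
    pow-multiple (suc q) = subst₂ _∼_ (sym (trans (cong (pow G g) (*-suc (suc m) q)) (pow-+ g (suc m) (suc m * q))))
                                  (identityˡ ε) (∙-∼ (∈⇒∼ε pow-order-∈) (pow-multiple q))

    pow-∼-% : ∀ e → pow G g e ∼ pow G g (e % suc m)
    pow-∼-% e = subst₂ _∼_ (sym split) (identityʳ _) (∙-∼ (∼-refl {pow G g (e % suc m)}) (pow-multiple (e / suc m)))
      where
      split : pow G g e ≡ pow G g (e % suc m) ∙ pow G g (suc m * (e / suc m))
      split = trans (cong (pow G g) (digits (suc m) e)) (pow-+ g (e % suc m) (suc m * (e / suc m)))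

  record IsCyclicSeries (ns : List ℕ) (Gs : Fin (suc (length ns)) → Subset n) : Set where
    field
      subgroup : ∀ s → IsSubgroup G (Gs s)
      incl     : ∀ (s : Fin (length ns)) → Gs (inject₁ s) ⊆ Gs (Fin.suc s)
      quotient : ∀ (s : Fin (length ns)) → CyclicQuotientOfOrder G (Gs (Fin.suc s)) (Gs (inject₁ s)) (lookup ns s)

  open IsCyclicSeries

  tail : ∀ {m ms Gs} → IsCyclicSeries (m ∷ ms) Gs → IsCyclicSeries ms (λ s → Gs (Fin.suc s))
  tail C = record { subgroup = λ s → subgroup C (Fin.suc s) ; incl = λ s → incl C (Fin.suc s)
                  ; quotient = λ s → quotient C (Fin.suc s) }

  bottom⊆top : ∀ {ns Gs} → IsCyclicSeries ns Gs → Gs Fin.zero ⊆ Gs (fromℕ (length ns))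
  bottom⊆top {[]}     C x∈ = x∈
  bottom⊆top {m ∷ ms} C x∈ = bottom⊆top (tail C) (incl C Fin.zero x∈)

  infix 4 _∼[_]_
  _∼[_]_ : ∀ {ns Gs} → Fin n → IsCyclicSeries ns Gs → Fin n → Set
  x ∼[ C ] y = Modulo._∼_ _ (subgroup C Fin.zero) x y

  -- The element with mixed radix digits (a₁, …, aₜ) is g₁^a₁ ⋯ gₜ^aₜ, gₛ generating Gₛ/Gₛ₋₁.
  coordinate : ∀ {ns Gs} → IsCyclicSeries ns Gs → ℕ → Fin n
  coordinate {[]}         C a = ε
  coordinate {zero  ∷ ms} C a = ε
  coordinate {suc m ∷ ms} C a = pow G (proj₁ (quotient C Fin.zero)) (a % suc m) ∙ coordinate (tail C) (a / suc m)

  module Bottom {m : ℕ} {ms : List ℕ} {Gs : Fin (suc (suc (length ms))) → Subset n} (C : IsCyclicSeries (suc m ∷ ms) Gs) where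
    open Modulo (Gs Fin.zero) (subgroup C Fin.zero) public
    module Above = Modulo (Gs (Fin.suc Fin.zero)) (subgroup C (Fin.suc Fin.zero))
    open CyclicQuotient (subgroup C Fin.zero) (subgroup C (Fin.suc Fin.zero)) (quotient C Fin.zero) public

    φ φ′ : ℕ → Fin n
    φ  = coordinate C
    φ′ = coordinate (tail C)

    coordinate-digits : ∀ {k} c → k < suc m → φ (k + suc m * c) ≡ pow G g k ∙ φ′ c
    coordinate-digits c k< = cong₂ (λ x y → pow G g x ∙ φ′ y) (%-digits (suc m) c k<) (/-digits (suc m) c k<)

  coordinate-∈ : ∀ {ns Gs} (C : IsCyclicSeries ns Gs) a → coordinate C a ∈ Gs (fromℕ (length ns))
  coordinate-∈ {[]}         C a = IsSubgroup.ε-mem (subgroup C Fin.zero)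
  coordinate-∈ {zero  ∷ ms} C a = IsSubgroup.ε-mem (subgroup C _)
  coordinate-∈ {suc m ∷ ms} C a =
    ∙-mem _ _ (Modulo.pow-∈ _ (subgroup C _) (a % suc m) (bottom⊆top (tail C) g∈A)) (coordinate-∈ (tail C) (a / suc m))
    where
    open Bottom C using (g∈A)
    open IsSubgroup (subgroup C (fromℕ (length (suc m ∷ ms))))

  coordinate-0 : ∀ {ns Gs} (C : IsCyclicSeries ns Gs) → coordinate C 0 ≡ ε
  coordinate-0 {[]}         C = refl
  coordinate-0 {zero  ∷ ms} C = refl
  coordinate-0 {suc m ∷ ms} C = trans (identityˡ _) (coordinate-0 (tail C))

  coordinate-injective : ∀ {ns Gs} (C : IsCyclicSeries ns Gs) {a b} → a < product ns → b < product ns →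
                         coordinate C a ∼[ C ] coordinate C b → a ≡ b
  coordinate-injective {[]} C {zero}  {zero}  _        _        _ = refl
  coordinate-injective {[]} C {zero}  {suc _} _        (s≤s ()) _
  coordinate-injective {[]} C {suc _}         (s≤s ()) _        _
  coordinate-injective {suc m ∷ ms} C {a} {b} a< b< φa∼φb =
    trans (digits (suc m) a) (trans (cong₂ (λ x y → x + suc m * y) a%≡b% a/≡b/) (sym (digits (suc m) b)))
    where
    open Bottom C
    a/≡b/ : a / suc m ≡ b / suc m
    a/≡b/ = coordinate-injective (tail C) (/-< (suc m) _ a<) (/-< (suc m) _ b<)
              (Above.∼-cancelˡ (incl C Fin.zero φa∼φb)
                 (Above.∈-∼ (Above.pow-∈ (a % suc m) g∈A) (Above.pow-∈ (b % suc m) g∈A)))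
    a%≡b% : a % suc m ≡ b % suc m
    a%≡b% = pow-injective _ _ (m%n<n a (suc m)) (m%n<n b (suc m)) (∼-cancelʳ φa∼φb (∼-reflexive (cong φ′ a/≡b/)))

  coordinate-surjective : ∀ {ns Gs} (C : IsCyclicSeries ns Gs) → All (1 <_) ns →
                          ∀ x → x ∈ Gs (fromℕ (length ns)) → ∃ λ c → c < product ns × x ∼[ C ] coordinate C c
  coordinate-surjective {[]} C _ x x∈ = 0 , z<s , Modulo.∈⇒∼ε _ (subgroup C Fin.zero) x∈
  coordinate-surjective {suc m ∷ ms} C (_ ∷ ms>1) x x∈ =
    let (c′ , c′< , x∼φ′c′) = coordinate-surjective (tail C) ms>1 x x∈
        (k , k< , xφ′c′⁻¹∼gᵏ) = pow-surjective (x ∙ φ′ c′ ⁻¹) x∼φ′c′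
        x∼gᵏφ′c′ = subst (_∼ pow G g k ∙ φ′ c′) (x∙y⁻¹∙y≡x x (φ′ c′)) (∙-∼ xφ′c′⁻¹∼gᵏ ∼-refl)
    in k + suc m * c′ , digits-< (suc m) k< c′< , subst (x ∼_) (sym (coordinate-digits c′ k<)) x∼gᵏφ′c′
    where open Bottom C

  coordinate-carryFree : ∀ {ns Gs} (C : IsCyclicSeries ns Gs) {a b} → a < product ns → b < product ns → CarryFree ns a b →
                         a + b < product ns × coordinate C a ∙ coordinate C b ≡ coordinate C (a + b)
  coordinate-carryFree {[]} C {zero}  {zero}  _        _        _ = z<s , identityˡ ε
  coordinate-carryFree {[]} C {zero}  {suc _} _        (s≤s ()) _
  coordinate-carryFree {[]} C {suc _}         (s≤s ()) _        _
  coordinate-carryFree {suc m ∷ ms} C {a} {b} a< b< (low< , c′) =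
    subst (_< suc m * product ms) (sym a+b≡) (digits-< (suc m) low< (proj₁ high)) , product≡
    where
    open Bottom C
    open ≡-Reasoning
    a₀ = a % suc m
    b₀ = b % suc m
    a′ = a / suc m
    b′ = b / suc m
    high : a′ + b′ < product ms × φ′ a′ ∙ φ′ b′ ≡ φ′ (a′ + b′)
    high = coordinate-carryFree (tail C) (/-< (suc m) _ a<) (/-< (suc m) _ b<) c′
    a+b≡ : a + b ≡ (a₀ + b₀) + suc m * (a′ + b′)
    a+b≡ = trans (cong₂ _+_ (digits (suc m) a) (digits (suc m) b)) (regroup a₀ a′ b₀ (suc m) b′)
      where
      regroup : ∀ p q r s t → (p + s * q) + (r + s * t) ≡ (p + r) + s * (q + t)
      regroup = solve-∀
    product≡ : φ a ∙ φ b ≡ φ (a + b)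
    product≡ = begin
      (pow G g a₀ ∙ φ′ a′) ∙ (pow G g b₀ ∙ φ′ b′) ≡⟨ interchange _ _ _ _ ⟩
      (pow G g a₀ ∙ pow G g b₀) ∙ (φ′ a′ ∙ φ′ b′) ≡⟨ cong₂ _∙_ (sym (pow-+ g a₀ b₀)) (proj₂ high) ⟩
      pow G g (a₀ + b₀) ∙ φ′ (a′ + b′)            ≡⟨ coordinate-digits (a′ + b′) low< ⟨
      φ ((a₀ + b₀) + suc m * (a′ + b′))            ≡⟨ cong φ a+b≡ ⟨
      φ (a + b)                                    ∎

  module _ {ns : List ℕ} {Gs : Fin (suc (length ns)) → Subset n} (C : IsCyclicSeries ns Gs) (ns>1 : All (1 <_) ns) where

    private
      product-coordinate : ∀ a b → ∃ λ c → c < product ns × coordinate C a ∙ coordinate C b ∼[ C ] coordinate C c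
      product-coordinate a b = coordinate-surjective C ns>1 _
        (IsSubgroup.∙-mem (subgroup C _) _ _ (coordinate-∈ C a) (coordinate-∈ C b))

    productIndex : ℕ → ℕ → ℕ
    productIndex a b = proj₁ (product-coordinate a b)

    productIndex-< : ∀ a b → productIndex a b < product ns
    productIndex-< a b = proj₁ (proj₂ (product-coordinate a b))

    productIndex-∼ : ∀ a b → coordinate C a ∙ coordinate C b ∼[ C ] coordinate C (productIndex a b)
    productIndex-∼ a b = proj₂ (proj₂ (product-coordinate a b))

  module ProductStep {m : ℕ} {ms : List ℕ} {Gs : Fin (suc (suc (length ms))) → Subset n}
                     (C : IsCyclicSeries (suc m ∷ ms) Gs) (m>1 : 1 < suc m) (ms>1 : All (1 <_) ms) where

    open Bottom C

    f f′ : ℕ → ℕ → ℕ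
    f  = productIndex C (m>1 ∷ ms>1)
    f′ = productIndex (tail C) ms>1

    -- the defect of the coordinates of the higher parts lies in G₁, i.e. is a power of g modulo G₀
    private
      twist-exists : ∀ a′ b′ → ∃ λ k → k < suc m × (φ′ a′ ∙ φ′ b′) ∙ φ′ (f′ a′ b′) ⁻¹ ∼ pow G g k
      twist-exists a′ b′ = pow-surjective _ (productIndex-∼ (tail C) ms>1 a′ b′)

    twist : ℕ → ℕ → ℕ
    twist a′ b′ = proj₁ (twist-exists a′ b′)

    higher-∼ : ∀ a′ b′ → φ′ a′ ∙ φ′ b′ ∼ pow G g (twist a′ b′) ∙ φ′ (f′ a′ b′)
    higher-∼ a′ b′ = subst (_∼ pow G g (twist a′ b′) ∙ φ′ (f′ a′ b′)) (x∙y⁻¹∙y≡x _ _)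
                           (∙-∼ (proj₂ (proj₂ (twist-exists a′ b′))) ∼-refl)

    twist-carryFree : ∀ a′ b′ → a′ < product ms → b′ < product ms → CarryFree ms a′ b′ → twist a′ b′ ≡ 0
    twist-carryFree a′ b′ a′< b′< c′ = sym (pow-injective 0 _ z<s (proj₁ (proj₂ (twist-exists a′ b′))) ε∼gᵏ)
      where
      sum : a′ + b′ < product ms × φ′ a′ ∙ φ′ b′ ≡ φ′ (a′ + b′)
      sum = coordinate-carryFree (tail C) a′< b′< c′
      f′≡+ : f′ a′ b′ ≡ a′ + b′
      f′≡+ = coordinate-injective (tail C) (productIndex-< (tail C) ms>1 a′ b′) (proj₁ sum)
               (Above.∼-sym (subst (Above._∼ φ′ (f′ a′ b′)) (proj₂ sum) (productIndex-∼ (tail C) ms>1 a′ b′)))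
      ε∼gᵏ : ε ∼ pow G g (twist a′ b′)
      ε∼gᵏ = subst (_∼ pow G g (twist a′ b′))
                   (trans (cong₂ (λ x y → x ∙ φ′ y ⁻¹) (proj₂ sum) f′≡+) (inverseʳ _))
                   (proj₂ (proj₂ (twist-exists a′ b′)))

    twistStep : TwistStep m ms f f′ twist
    twistStep a b a< b< = coordinate-injective C (productIndex-< C (m>1 ∷ ms>1) a b) digit-form<
                            (∼-trans (∼-sym (productIndex-∼ C (m>1 ∷ ms>1) a b)) product-∼)
      where
      a₀ = a % suc m
      b₀ = b % suc m
      a′ = a / suc m
      b′ = b / suc m
      k = twist a′ b′
      d = (a₀ + b₀ + k) % suc m
      digit-form< : d + suc m * f′ a′ b′ < suc m * product ms
      digit-form< = digits-< (suc m) (m%n<n (a₀ + b₀ + k) (suc m)) (productIndex-< (tail C) ms>1 a′ b′)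
      product-∼ : φ a ∙ φ b ∼ φ (d + suc m * f′ a′ b′)
      product-∼ = begin
        φ a ∙ φ b                                    ≡⟨ interchange _ _ _ _ ⟩
        (pow G g a₀ ∙ pow G g b₀) ∙ (φ′ a′ ∙ φ′ b′)  ≡⟨ cong (_∙ (φ′ a′ ∙ φ′ b′)) (pow-+ g a₀ b₀) ⟨
        pow G g (a₀ + b₀) ∙ (φ′ a′ ∙ φ′ b′)          ∼⟨ ∙-∼ ∼-refl (higher-∼ a′ b′) ⟩
        pow G g (a₀ + b₀) ∙ (pow G g k ∙ φ′ (f′ a′ b′)) ≡⟨ assoc _ _ _ ⟨
        (pow G g (a₀ + b₀) ∙ pow G g k) ∙ φ′ (f′ a′ b′) ≡⟨ cong (_∙ φ′ (f′ a′ b′)) (pow-+ g (a₀ + b₀) k) ⟨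
        pow G g (a₀ + b₀ + k) ∙ φ′ (f′ a′ b′)        ∼⟨ ∙-∼ (pow-∼-% (a₀ + b₀ + k)) ∼-refl ⟩
        pow G g d ∙ φ′ (f′ a′ b′)                    ≡⟨ coordinate-digits (f′ a′ b′) (m%n<n (a₀ + b₀ + k) (suc m)) ⟨
        φ (d + suc m * f′ a′ b′)                     ∎
        where open ∼-Reasoning

  productIndex-twisted : ∀ {ns Gs} (C : IsCyclicSeries ns Gs) (ns>1 : All (1 <_) ns) → TwistedAddition ns (productIndex C ns>1)
  productIndex-twisted {[]}         C []           = twist-[] refl
  productIndex-twisted {suc m ∷ ms} C (m>1 ∷ ms>1) =
    twist-∷ f′ twist (productIndex-twisted (tail C) ms>1) twist-carryFree twistStep
    where open ProductStep C m>1 ms>1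

-- Finite sets

x∉p⇒∣p∪⁅x⁆∣≡1+∣p∣ : ∀ {k} (p : Subset k) (x : Fin k) → x ∉ p → ∣ p ∪ ⁅ x ⁆ ∣ ≡ suc ∣ p ∣
x∉p⇒∣p∪⁅x⁆∣≡1+∣p∣ (outside ∷ p) Fin.zero    _   = cong suc (cong ∣_∣ (∪-identityʳ p))
x∉p⇒∣p∪⁅x⁆∣≡1+∣p∣ (inside  ∷ p) Fin.zero    x∉p = ⊥-elim (x∉p here)
x∉p⇒∣p∪⁅x⁆∣≡1+∣p∣ (outside ∷ p) (Fin.suc x) x∉p = x∉p⇒∣p∪⁅x⁆∣≡1+∣p∣ p x (λ x∈p → x∉p (there x∈p))
x∉p⇒∣p∪⁅x⁆∣≡1+∣p∣ (inside  ∷ p) (Fin.suc x) x∉p = cong suc (x∉p⇒∣p∪⁅x⁆∣≡1+∣p∣ p x (λ x∈p → x∉p (there x∈p)))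

injective⇒onto : ∀ M (f : Fin M → ℕ) → (∀ i → f i < M) → (∀ i j → f i ≡ f j → i ≡ j) → ∀ c → c < M → ∃ λ i → f i ≡ c
injective⇒onto (suc M) f f< f-injective c c< with any? (λ i → fromℕ< (f< i) ≟ᶠ fromℕ< c<)
... | yes (i , fi≡c) = i , fromℕ<-injective (f i) c (f< i) c< fi≡c
... | no  c∉image    = ⊥-elim (<-irrefl refl (injective⇒≤ {f = squeeze} squeeze-injective))
  where
  missed : ∀ i → fromℕ< c< ≢ fromℕ< (f< i)
  missed i c≡fi = c∉image (i , sym c≡fi)
  squeeze : Fin (suc M) → Fin M
  squeeze i = punchOut (missed i)
  squeeze-injective : ∀ {i j} → squeeze i ≡ squeeze j → i ≡ j
  squeeze-injective {i} {j} eq =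
    f-injective i j (fromℕ<-injective (f i) (f j) (f< i) (f< j) (punchOut-injective (missed i) (missed j) eq))

least : (P : ℕ → Set) → (∀ i → Dec (P i)) → ∀ K → P K → ∃ λ i → P i × (∀ j → P j → i ≤ j)
least P P? zero    PK = 0 , PK , λ _ _ → z≤n
least P P? (suc K) PK with P? 0
... | yes P0 = 0 , P0 , λ _ _ → z≤n
... | no ¬P0 with least (P ∘ suc) (P? ∘ suc) K PK
...   | i , Pi , minimal = suc i , Pi , λ { zero P0 → ⊥-elim (¬P0 P0) ; (suc j) Pj → s≤s (minimal j Pj) }

two-new-elements : ∀ {k} {p q : Subset k} {x y} → p ⊆ q → x ∈ q → y ∈ q → x ∉ p → y ∉ p → x ≢ y → 2 + ∣ p ∣ ≤ ∣ q ∣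
two-new-elements {p = p} {q} {x} {y} p⊆q x∈q y∈q x∉p y∉p x≢y = subst (_≤ ∣ q ∣) size (p⊆q⇒∣p∣≤∣q∣ p∪x∪y⊆q)
  where
  y∉p∪x : y ∉ p ∪ ⁅ x ⁆
  y∉p∪x y∈ with x∈p∪q⁻ p ⁅ x ⁆ y∈
  ... | inj₁ y∈p = y∉p y∈p
  ... | inj₂ y∈x = x≢y (sym (x∈⁅y⁆⇒x≡y x y∈x))
  size : ∣ (p ∪ ⁅ x ⁆) ∪ ⁅ y ⁆ ∣ ≡ 2 + ∣ p ∣
  size = trans (x∉p⇒∣p∪⁅x⁆∣≡1+∣p∣ _ y y∉p∪x) (cong suc (x∉p⇒∣p∪⁅x⁆∣≡1+∣p∣ p x x∉p))
  p∪x∪y⊆q : (p ∪ ⁅ x ⁆) ∪ ⁅ y ⁆ ⊆ q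
  p∪x∪y⊆q z∈ with x∈p∪q⁻ (p ∪ ⁅ x ⁆) ⁅ y ⁆ z∈
  ... | inj₂ z∈y = subst (_∈ q) (sym (x∈⁅y⁆⇒x≡y y z∈y)) y∈q
  ... | inj₁ z∈p∪x with x∈p∪q⁻ p ⁅ x ⁆ z∈p∪x
  ...   | inj₁ z∈p = p⊆q z∈p
  ...   | inj₂ z∈x = subst (_∈ q) (sym (x∈⁅y⁆⇒x≡y x z∈x)) x∈q

IsLeast-resp-⇔ : ∀ {k} {P Q : Fin k → Set} → (∀ x → P x ⇔ Q x) → ∀ x → IsLeast P x → IsLeast Q x
IsLeast-resp-⇔ P⇔Q x (Px , least) = Equivalence.to (P⇔Q x) Px , λ y Qy → least y (Equivalence.from (P⇔Q y) Qy)

-- From a filtration to a flag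

module Enumeration {N : ℕ} (G : FiniteAbelianGroup N) (φ : ℕ → Fin N)
                   (φ-injective : ∀ {a b} → a < N → b < N → φ a ≡ φ b → a ≡ b) where

  open FiniteAbelianGroup G

  prefix : ℕ → Subset N
  prefix zero    = ⁅ φ 0 ⁆
  prefix (suc i) = prefix i ∪ ⁅ φ (suc i) ⁆

  ∈-prefix⁻ : ∀ i {x} → x ∈ prefix i → ∃ λ a → a ≤ i × φ a ≡ x
  ∈-prefix⁻ zero    x∈ = 0 , z≤n , sym (x∈⁅y⁆⇒x≡y _ x∈)
  ∈-prefix⁻ (suc i) x∈ with x∈p∪q⁻ (prefix i) ⁅ φ (suc i) ⁆ x∈
  ... | inj₁ x∈prefix with ∈-prefix⁻ i x∈prefix
  ...   | a , a≤i , φa≡x = a , m≤n⇒m≤1+n a≤i , φa≡x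
  ∈-prefix⁻ (suc i) x∈ | inj₂ x∈⁅φ⁆ = suc i , ≤-refl , sym (x∈⁅y⁆⇒x≡y _ x∈⁅φ⁆)

  ∈-prefix⁺ : ∀ i {a} → a ≤ i → φ a ∈ prefix i
  ∈-prefix⁺ zero    z≤n = x∈⁅x⁆ _
  ∈-prefix⁺ (suc i) a≤ with m≤n⇒m<n∨m≡n a≤
  ... | inj₁ a<1+i = x∈p∪q⁺ (inj₁ (∈-prefix⁺ i (s≤s⁻¹ a<1+i)))
  ... | inj₂ refl  = x∈p∪q⁺ {p = prefix i} (inj₂ (x∈⁅x⁆ _))

  ∣prefix∣ : ∀ i → i < N → ∣ prefix i ∣ ≡ suc i
  ∣prefix∣ zero    _    = ∣⁅x⁆∣≡1 (φ 0)
  ∣prefix∣ (suc i) 1+i< = trans (x∉p⇒∣p∪⁅x⁆∣≡1+∣p∣ (prefix i) (φ (suc i)) new) (cong suc (∣prefix∣ i i<))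
    where
    i< : i < N
    i< = <-trans (n<1+n i) 1+i<
    new : φ (suc i) ∉ prefix i
    new φ∈ with ∈-prefix⁻ i φ∈
    ... | a , a≤i , φa≡ = <-irrefl (φ-injective (≤-<-trans a≤i i<) 1+i< φa≡) (s≤s a≤i)

  F : Fin N → Subset N
  F i = prefix (toℕ i)

  prefix-flag : φ 0 ≡ ε → IsFlag G F
  prefix-flag φ0≡ε = record
    { first = λ i i≡0 → trans (cong prefix i≡0) (cong ⁅_⁆ φ0≡ε)
    ; last  = λ i 1+i≡N → ∣p∣≡n⇒p≡⊤ (trans (∣prefix∣ (toℕ i) (toℕ<n i)) 1+i≡N)
    ; chain = λ i j i≤j {x} x∈ → let (a , a≤i , φa≡x) = ∈-prefix⁻ (toℕ i) x∈
                                 in subst (_∈ F j) φa≡x (∈-prefix⁺ (toℕ j) (≤-trans a≤i i≤j))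
    ; size  = λ i → ∣prefix∣ (toℕ i) (toℕ<n i) }

  prodSub⇔ : (table : ℕ → ℕ → ℕ) → (∀ a b → table a b < N) → (∀ a b → φ a ∙ φ b ≡ φ (table a b)) →
             ∀ i j k → ProdSub G F i j k ⇔ (∀ a b → a ≤ toℕ i → b ≤ toℕ j → table a b ≤ toℕ k)
  prodSub⇔ table table< φ-hom i j k = mk⇔ to from
    where
    to : ProdSub G F i j k → ∀ a b → a ≤ toℕ i → b ≤ toℕ j → table a b ≤ toℕ k
    to prodSub a b a≤ b≤ with ∈-prefix⁻ (toℕ k) (prodSub (φ a) (φ b) (∈-prefix⁺ (toℕ i) a≤) (∈-prefix⁺ (toℕ j) b≤))
    ... | c , c≤k , φc≡ = subst (_≤ toℕ k) (φ-injective (≤-<-trans c≤k (toℕ<n k)) (table< a b) (trans φc≡ (φ-hom a b))) c≤k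
    from : (∀ a b → a ≤ toℕ i → b ≤ toℕ j → table a b ≤ toℕ k) → ProdSub G F i j k
    from bound x y x∈ y∈ with ∈-prefix⁻ (toℕ i) x∈ | ∈-prefix⁻ (toℕ j) y∈
    ... | a , a≤ , refl | b , b≤ , refl = subst (_∈ F k) (sym (φ-hom a b)) (∈-prefix⁺ (toℕ k) (bound a b a≤ b≤))

filtration⇒realizable : ∀ {ns} → All (1 <_) ns → (G : FiniteAbelianGroup (product ns)) →
                        HasFiltration G ns → Realizable G ns
filtration⇒realizable {ns} ns>1 G (Gs , filtration) =
  F , prefix-flag (coordinate-0 C) , λ i j k → IsLeast-resp-⇔ (flag⇔tower i j) k , IsLeast-resp-⇔ (⇔-sym ∘ flag⇔tower i j) k
  where
  open GroupFacts G
  open CyclicSeries G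
  C : IsCyclicSeries ns Gs
  C = record { subgroup = IsFiltration.subgroup filtration ; incl = IsFiltration.incl filtration
             ; quotient = IsFiltration.quotient filtration }
  ∼⇒≡ : ∀ {x y} → x ∼[ C ] y → x ≡ y
  ∼⇒≡ {x} {y} x∼y = x∙y⁻¹≈ε⇒x≈y x y (x∈⁅y⁆⇒x≡y ε (subst (x ∙ y ⁻¹ ∈_) (IsFiltration.bottom filtration Fin.zero refl) x∼y))
  open Enumeration G (coordinate C)
    (λ a< b< φa≡φb → coordinate-injective C a< b< (Modulo.∼-reflexive _ (IsCyclicSeries.subgroup C Fin.zero) φa≡φb))
  flag⇔tower : ∀ i j k → ProdSub G F i j k ⇔ TowerProdSub ns i j k
  flag⇔tower i j k =
    ⇔-trans (prodSub⇔ (productIndex C ns>1) (productIndex-< C ns>1) (λ a b → ∼⇒≡ (productIndex-∼ C ns>1 a b)) i j k)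
    (⇔-trans (twisted-box-bound⇔ (productIndex-twisted C ns>1) (toℕ<n i) (toℕ<n j) (toℕ k))
             (⇔-sym (twisted-box-bound⇔ (addMR-twisted ns>1) (toℕ<n i) (toℕ<n j) (toℕ k))))

-- From a flag to a filtration

module FlagPositions {N : ℕ} (G : FiniteAbelianGroup N) {F : Fin N → Subset N} (flag : IsFlag G F) where

  open GroupFacts G
  open IsFlag flag

  0<N : 0 < N
  0<N = ≤-<-trans z≤n (toℕ<n ε)

  flagAt : ∀ {i} → i < N → Subset N
  flagAt i< = F (fromℕ< i<)

  private
    InFlag : Fin N → ℕ → Set
    InFlag x i = Σ (i < N) λ i< → x ∈ flagAt i<

    inFlag? : ∀ x i → Dec (InFlag x i)
    inFlag? x i with i <? N
    ... | no  i≮N = no λ (i< , _) → i≮N i<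
    ... | yes i<  with x ∈? flagAt i<
    ...   | yes x∈ = yes (i< , x∈)
    ...   | no  x∉ = no λ (i<′ , x∈) → x∉ (subst (λ p → x ∈ F (fromℕ< p)) (<-irrelevant i<′ i<) x∈)

    in-last : ∀ x → InFlag x (pred N)
    in-last x = N-1< , subst (x ∈_) (sym (last (fromℕ< N-1<) (trans (cong suc (toℕ-fromℕ< N-1<)) N-1+1≡N))) ∈⊤
      where
      N-1+1≡N : suc (pred N) ≡ N
      N-1+1≡N = suc-pred N {{>-nonZero 0<N}}
      N-1< : pred N < N
      N-1< = subst (pred N <_) N-1+1≡N ≤-refl

    least-index : ∀ x → ∃ λ i → InFlag x i × (∀ j → InFlag x j → i ≤ j)
    least-index x = least (InFlag x) (inFlag? x) (pred N) (in-last x)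

  pos : Fin N → ℕ
  pos x = proj₁ (least-index x)

  pos< : ∀ x → pos x < N
  pos< x = proj₁ (proj₁ (proj₂ (least-index x)))

  ∈⇒pos≤ : ∀ {x i} (i< : i < N) → x ∈ flagAt i< → pos x ≤ i
  ∈⇒pos≤ i< x∈ = proj₂ (proj₂ (least-index _)) _ (i< , x∈)

  flagAt-mono : ∀ {i j} (i< : i < N) (j< : j < N) → i ≤ j → flagAt i< ⊆ flagAt j<
  flagAt-mono i< j< i≤j = chain (fromℕ< i<) (fromℕ< j<) (subst₂ _≤_ (sym (toℕ-fromℕ< i<)) (sym (toℕ-fromℕ< j<)) i≤j)

  pos≤⇒∈ : ∀ {x i} (i< : i < N) → pos x ≤ i → x ∈ flagAt i<
  pos≤⇒∈ {x} i< pos≤i = flagAt-mono (pos< x) i< pos≤i (proj₂ (proj₁ (proj₂ (least-index x))))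

  flagAt-0 : flagAt 0<N ≡ ⁅ ε ⁆
  flagAt-0 = first (fromℕ< 0<N) (toℕ-fromℕ< 0<N)

  pos-ε : pos ε ≡ 0
  pos-ε = n≤0⇒n≡0 (∈⇒pos≤ 0<N (subst (ε ∈_) (sym flagAt-0) (x∈⁅x⁆ ε)))

  pos≡0⇒ε : ∀ {x} → pos x ≡ 0 → x ≡ ε
  pos≡0⇒ε {x} pos≡0 = x∈⁅y⁆⇒x≡y ε (subst (x ∈_) flagAt-0 (pos≤⇒∈ 0<N (≤-reflexive pos≡0)))

  ∣flagAt∣ : ∀ {i} (i< : i < N) → ∣ flagAt i< ∣ ≡ suc i
  ∣flagAt∣ i< = trans (size (fromℕ< i<)) (cong suc (toℕ-fromℕ< i<))

  pos-injective : ∀ x y → pos x ≡ pos y → x ≡ y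
  pos-injective x y pos≡ with pos x in pos-x≡ | x ≟ᶠ y
  ... | _     | yes x≡y = x≡y
  ... | zero  | no  _   = trans (pos≡0⇒ε pos-x≡) (sym (pos≡0⇒ε (sym pos≡)))
  ... | suc i | no  x≢y = ⊥-elim (<-irrefl refl (subst₂ _≤_ (cong (2 +_) (∣flagAt∣ i<)) (∣flagAt∣ 1+i<) too-big))
    where
    1+i< : suc i < N
    1+i< = subst (_< N) pos-x≡ (pos< x)
    i< : i < N
    i< = <-trans (n<1+n i) 1+i<
    too-big : 2 + ∣ flagAt i< ∣ ≤ ∣ flagAt 1+i< ∣
    too-big = two-new-elements (flagAt-mono i< 1+i< (n≤1+n i))
      (pos≤⇒∈ 1+i< (≤-reflexive pos-x≡)) (pos≤⇒∈ 1+i< (≤-reflexive (sym pos≡)))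
      (λ x∈ → 1+n≰n (subst (_≤ i) pos-x≡ (∈⇒pos≤ i< x∈))) (λ y∈ → 1+n≰n (subst (_≤ i) (sym pos≡) (∈⇒pos≤ i< y∈)))
      x≢y

  pos-onto : ∀ c → c < N → ∃ λ x → pos x ≡ c
  pos-onto = injective⇒onto N pos pos< pos-injective

  translate-onto : (t : Fin N → Fin N) → (∀ {y z} → t y ≡ t z → y ≡ z) → ∀ A {M} → M ≤ N →
                   (∀ y → pos y < M → A ≤ pos (t y) × pos (t y) < A + M) →
                   ∀ {c} → A ≤ c → c < A + M → ∃ λ y → pos y < M × pos (t y) ≡ c
  translate-onto t t-injective A {M} M≤N into {c} A≤c c<A+M =
    let (i , fi≡c-A) = injective⇒onto M f f< f-injective (c ∸ A) c-A<M
    in y i , y< i , ∸-cancelʳ-≡ (proj₁ (into (y i) (y< i))) A≤c fi≡c-A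
    where
    y : Fin M → Fin N
    y i = proj₁ (pos-onto (toℕ i) (<-≤-trans (toℕ<n i) M≤N))
    pos-y : ∀ i → pos (y i) ≡ toℕ i
    pos-y i = proj₂ (pos-onto (toℕ i) (<-≤-trans (toℕ<n i) M≤N))
    y< : ∀ i → pos (y i) < M
    y< i = subst (_< M) (sym (pos-y i)) (toℕ<n i)
    f : Fin M → ℕ
    f i = pos (t (y i)) ∸ A
    interval-< : ∀ {v} → A ≤ v → v < A + M → v ∸ A < M
    interval-< A≤v v< = subst (_ <_) (m+n∸m≡n A M) (∸-monoˡ-< v< A≤v)
    f< : ∀ i → f i < M
    f< i = interval-< (proj₁ (into (y i) (y< i))) (proj₂ (into (y i) (y< i)))
    f-injective : ∀ i j → f i ≡ f j → i ≡ j
    f-injective i j fi≡fj = toℕ-injective (trans (sym (pos-y i)) (trans (cong pos yi≡yj) (pos-y j)))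
      where
      yi≡yj : y i ≡ y j
      yi≡yj = t-injective (pos-injective _ _ (∸-cancelʳ-≡ (proj₁ (into (y i) (y< i))) (proj₁ (into (y j) (y< j))) fi≡fj))
    c-A<M : c ∸ A < M
    c-A<M = interval-< A≤c c<A+M

  module _ {L : ℕ} (0<L : 0 < L) (L≤N : L ≤ N) where

    private
      instance _ = >-nonZero 0<L
      L-1< : pred L < N
      L-1< = <-≤-trans (subst (pred L <_) (suc-pred L) ≤-refl) L≤N

    below : Subset N
    below = flagAt L-1<

    ∈below⇒pos< : ∀ {x} → x ∈ below → pos x < L
    ∈below⇒pos< x∈ = m≤pred[n]⇒suc[m]≤n (∈⇒pos≤ L-1< x∈)

    pos<⇒∈below : ∀ {x} → pos x < L → x ∈ below
    pos<⇒∈below pos< = pos≤⇒∈ L-1< (<⇒≤pred pos<)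

    below-1 : L ≡ 1 → below ≡ ⁅ ε ⁆
    below-1 L≡1 = first (fromℕ< L-1<) (trans (toℕ-fromℕ< L-1<) (cong pred L≡1))

    below-N : L ≡ N → below ≡ Data.Fin.Subset.⊤
    below-N L≡N = last (fromℕ< L-1<) (trans (cong suc (toℕ-fromℕ< L-1<)) (trans (suc-pred L) L≡N))

    closed⇒subgroup : (∀ x y → pos x < L → pos y < L → pos (x ∙ y) < L) → IsSubgroup G below
    closed⇒subgroup closed = record
      { ε-mem  = pos<⇒∈below (subst (_< L) (sym pos-ε) 0<L)
      ; ∙-mem  = λ x y x∈ y∈ → pos<⇒∈below (closed x y (∈below⇒pos< x∈) (∈below⇒pos< y∈))
      ; ⁻¹-mem = λ x x∈ → pos<⇒∈below (pos-⁻¹ x (∈below⇒pos< x∈)) }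
      where
      -- left multiplication by x permutes {y : pos y < L}, so x y = ε for some y in it
      pos-⁻¹ : ∀ x → pos x < L → pos (x ⁻¹) < L
      pos-⁻¹ x x< = subst (λ z → pos z < L) y≡x⁻¹ (proj₁ (proj₂ solution))
        where
        solution : ∃ λ y → pos y < L × pos (x ∙ y) ≡ 0
        solution = translate-onto (x ∙_) (λ {y} {z} → ∙-cancelˡ x y z) 0 L≤N (λ y y< → z≤n , closed x y x< y<) z≤n 0<L
        y≡x⁻¹ : proj₁ solution ≡ x ⁻¹
        y≡x⁻¹ = ∙-cancelˡ x _ (x ⁻¹) (trans (pos≡0⇒ε (proj₂ (proj₂ solution))) (sym (inverseʳ x)))

module FromFlag {ns : List ℕ} (ns>1 : All (1 <_) ns) (G : FiniteAbelianGroup (product ns))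
                {F : Fin (product ns) → Subset (product ns)} (flag : IsFlag G F)
                (type≡ : ∀ i j k → (FlagTypeIs G F i j k → TowerTypeIs ns i j k) × (TowerTypeIs ns i j k → FlagTypeIs G F i j k))
                where

  open GroupFacts G
  open FlagPositions G flag

  N : ℕ
  N = product ns

  PosBound : ℕ → ℕ → ℕ → Set
  PosBound i j k = ∀ x y → pos x ≤ i → pos y ≤ j → pos (x ∙ y) ≤ k

  flag-type : ∀ {i j k} → i < N → j < N → k < N →
              (∀ a b → a ≤ i → b ≤ j → addMR ns a b ≤ k) → (∃₂ λ a b → a ≤ i × b ≤ j × addMR ns a b ≡ k) →
              PosBound i j k × (∀ {k′} → k′ < N → PosBound i j k′ → k ≤ k′)
  flag-type {i} {j} {k} i< j< k< bound (a , b , a≤i , b≤j , ab≡k) = bounded , minimal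
    where
    i≡ : toℕ (fromℕ< i<) ≡ i
    i≡ = toℕ-fromℕ< i<
    j≡ : toℕ (fromℕ< j<) ≡ j
    j≡ = toℕ-fromℕ< j<
    k≡ : toℕ (fromℕ< k<) ≡ k
    k≡ = toℕ-fromℕ< k<
    tower : TowerTypeIs ns (fromℕ< i<) (fromℕ< j<) (fromℕ< k<)
    tower = (λ a′ b′ a′≤ b′≤ → subst (addMR ns a′ b′ ≤_) (sym k≡) (bound a′ b′ (subst (a′ ≤_) i≡ a′≤) (subst (b′ ≤_) j≡ b′≤)))
          , (λ k′ bound′ → subst (_≤ toℕ k′) (trans ab≡k (sym k≡))
                                 (bound′ a b (subst (a ≤_) (sym i≡) a≤i) (subst (b ≤_) (sym j≡) b≤j)))
    flagType : FlagTypeIs G F (fromℕ< i<) (fromℕ< j<) (fromℕ< k<)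
    flagType = proj₂ (type≡ _ _ _) tower
    bounded : PosBound i j k
    bounded x y x≤ y≤ = ∈⇒pos≤ k< (proj₁ flagType x y (pos≤⇒∈ i< x≤) (pos≤⇒∈ j< y≤))
    minimal : ∀ {k′} → k′ < N → PosBound i j k′ → k ≤ k′
    minimal k′< bound′ = subst₂ _≤_ k≡ (toℕ-fromℕ< k′<)
      (proj₂ flagType (fromℕ< k′<) λ x y x∈ y∈ → pos≤⇒∈ k′< (bound′ x y (∈⇒pos≤ i< x∈) (∈⇒pos≤ j< y∈)))

  place-closed : ∀ s → s ≤ length ns → ∀ x y → pos x < place s ns → pos y < place s ns → pos (x ∙ y) < place s ns
  place-closed s s≤ x y x< y< = m≤pred[n]⇒suc[m]≤n (proj₁ (flag-type L-1< L-1< L-1< bound attained) x y (<⇒≤pred x<) (<⇒≤pred y<))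
    where
    L : ℕ
    L = place s ns
    instance _ = >-nonZero (place-positive ns>1 s)
    L-1< : pred L < N
    L-1< = <-≤-trans (subst (pred L <_) (suc-pred L) ≤-refl) (place≤product ns>1 s s≤)
    bound : ∀ a b → a ≤ pred L → b ≤ pred L → addMR ns a b ≤ pred L
    bound a b a≤ b≤ = <⇒≤pred (addMR-place< s ns (m≤pred[n]⇒suc[m]≤n a≤) (m≤pred[n]⇒suc[m]≤n b≤))
    attained : ∃₂ λ a b → a ≤ pred L × b ≤ pred L × addMR ns a b ≡ pred L
    attained = pred L , 0 , ≤-refl , z≤n , addMR-identityʳ ns L-1<

  -- With M = n₁ ⋯ nₛ, H = {x : pos x < M} and pos g = M, gᵏ maps H onto the block [M k, M (k + 1)) for each k < nₛ₊₁.
  module Layer (s : Fin (length ns)) where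

    M m : ℕ
    M = place (toℕ s) ns
    m = lookup ns s

    0<M : 0 < M
    0<M = place-positive ns>1 (toℕ s)

    instance
      M-nonZero : NonZero M
      M-nonZero = >-nonZero 0<M

    1<m : 1 < m
    1<m = All.lookup ns>1 (∈-lookup s)

    Mm≤N : M * m ≤ N
    Mm≤N = subst (_≤ N) (place-suc ns s) (place≤product ns>1 (suc (toℕ s)) (toℕ<n s))

    M<Mm : M < M * m
    M<Mm = subst (_< M * m) (*-identityʳ M) (*-monoʳ-< M 1<m)

    M<N : M < N
    M<N = <-≤-trans M<Mm Mm≤N

    H-closed : ∀ x y → pos x < M → pos y < M → pos (x ∙ y) < M
    H-closed = place-closed (toℕ s) (<⇒≤ (toℕ<n s))

    pos-⁻¹ : ∀ {y} → pos y < M → pos (y ⁻¹) < M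
    pos-⁻¹ y< = ∈below⇒pos< 0<M (<⇒≤ M<N)
      (IsSubgroup.⁻¹-mem (closed⇒subgroup 0<M (<⇒≤ M<N) H-closed) _ (pos<⇒∈below 0<M (<⇒≤ M<N) y<))

    g : Fin N
    g = proj₁ (pos-onto M M<N)

    pos-g : pos g ≡ M
    pos-g = proj₂ (pos-onto M M<N)

    InLayer : ℕ → ℕ → Set
    InLayer k v = M * k ≤ v × v < M * suc k

    LayerMap : ℕ → Set
    LayerMap k = ∀ y → pos y < M → InLayer k (pos (pow G g k ∙ y))

    in-own-layer : ∀ v → InLayer (v / M) v
    in-own-layer v = subst (M * (v / M) ≤_) (sym (digits M v)) (m≤n+m _ (v % M))
                   , subst (_< M * suc (v / M)) (sym (digits M v)) (digits-< M (m%n<n v M) ≤-refl)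

    layer-unique : ∀ {k l v} → InLayer k v → InLayer l v → k ≡ l
    layer-unique {k} {l} (Mk≤v , v<) (Ml≤v , v<′) with <-cmp k l
    ... | tri≈ _ k≡l _ = k≡l
    ... | tri< k<l _ _ = ⊥-elim (<⇒≱ v< (≤-trans (*-monoʳ-≤ M k<l) Ml≤v))
    ... | tri> _ _ l<k = ⊥-elim (<⇒≱ v<′ (≤-trans (*-monoʳ-≤ M l<k) Mk≤v))

    layer-onto : ∀ {j} → LayerMap j → ∀ {c} → InLayer j c → ∃ λ y → pos y < M × pos (pow G g j ∙ y) ≡ c
    layer-onto {j} layer {c} (Mj≤c , c<) =
      translate-onto (pow G g j ∙_) (λ {y} {z} → ∙-cancelˡ (pow G g j) y z) (M * j) (<⇒≤ M<N) into Mj≤c (subst (c <_) M[1+j]≡ c<)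
      where
      M[1+j]≡ : M * suc j ≡ M * j + M
      M[1+j]≡ = trans (*-suc M j) (+-comm M (M * j))
      into : ∀ y → pos y < M → M * j ≤ pos (pow G g j ∙ y) × pos (pow G g j ∙ y) < M * j + M
      into y y< = proj₁ (layer y y<) , subst (pos (pow G g j ∙ y) <_) M[1+j]≡ (proj₂ (layer y y<))

    layer-decompose : ∀ {k} → (∀ j → j < k → LayerMap j) → ∀ {z} → pos z < M * k →
                      ∃₂ λ j w → j < k × pos w < M × pow G g j ∙ w ≡ z
    layer-decompose {k} layers {z} z< = j , proj₁ w , j<k , proj₁ (proj₂ w) , pos-injective _ z (proj₂ (proj₂ w))
      where
      j = pos z / M
      j<k : j < k
      j<k = /-< M k z<
      w : ∃ λ y → pos y < M × pos (pow G g j ∙ y) ≡ pos z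
      w = layer-onto (layers j j<k) (in-own-layer (pos z))

    private
      0<M[1+k] : ∀ k → 0 < M * suc k
      0<M[1+k] k = subst (_< M * suc k) (*-zeroʳ M) (*-monoʳ-< M z<s)

      pred-M[1+k] : ∀ k → pred (M * suc k) ≡ pred M + M * k
      pred-M[1+k] k = trans (cong pred (*-suc M k)) (pred-+ (M * k) 0<M)

      pred-M[1+k]< : ∀ {k} → k < m → pred (M * suc k) < N
      pred-M[1+k]< k<m = <-≤-trans (pred-mono-< {{>-nonZero (0<M[1+k] _)}} (n<1+n _)) (≤-trans (*-monoʳ-≤ M k<m) Mm≤N)

      ≤pred-M[1+k]⇒< : ∀ {k v} → v ≤ pred (M * suc k) → v < M * suc k
      ≤pred-M[1+k]⇒< {k} = m≤pred[n]⇒suc[m]≤n {{>-nonZero (0<M[1+k] k)}}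

    -- T(M, M (k + 1) - 1) = M (k + 2) - 1, as computed in the tower type
    layer-type : ∀ k → suc k < m →
                 PosBound M (pred (M * suc k)) (pred (M * suc (suc k))) ×
                 (∀ {k′} → k′ < N → PosBound M (pred (M * suc k)) k′ → pred (M * suc (suc k)) ≤ k′)
    layer-type k 1+k<m = flag-type M<N (pred-M[1+k]< (<-trans (n<1+n k) 1+k<m)) (pred-M[1+k]< 1+k<m) bound attained
      where
      bound : ∀ a b → a ≤ M → b ≤ pred (M * suc k) → addMR ns a b ≤ pred (M * suc (suc k))
      bound a b a≤ b≤ = <⇒≤pred (addMR-box ns s 1+k<m (≤-<-trans a≤ (subst (_< M * 2) (*-identityʳ M) (*-monoʳ-< M (n<1+n 1))))
                                                        (≤pred-M[1+k]⇒< b≤))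
      attained : ∃₂ λ a b → a ≤ M × b ≤ pred (M * suc k) × addMR ns a b ≡ pred (M * suc (suc k))
      attained = M * 1 , pred M + M * k , ≤-reflexive (*-identityʳ M) , ≤-reflexive (sym (pred-M[1+k] k)) ,
                 trans (addMR-exact ns s 1+k<m (subst (pred M <_) (suc-pred M) ≤-refl)) (sym (pred-M[1+k] (suc k)))

    layer-upper : ∀ k → suc k < m → ∀ x y → pos x ≤ M → pos y < M * suc k → pos (x ∙ y) < M * suc (suc k)
    layer-upper k 1+k<m x y x≤ y< = ≤pred-M[1+k]⇒< (proj₁ (layer-type k 1+k<m) x y x≤ (<⇒≤pred y<))

    layer-not-closed : ∀ k → suc k < m → ¬ (∀ x y → pos x ≤ M → pos y < M * suc k → pos (x ∙ y) < M * suc k)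
    layer-not-closed k 1+k<m closed = <⇒≱ (pred-mono-< {{>-nonZero (0<M[1+k] k)}} (*-monoʳ-< M (n<1+n (suc k))))
      (proj₂ (layer-type k 1+k<m) (pred-M[1+k]< (<-trans (n<1+n k) 1+k<m))
        (λ x y x≤ y≤ → <⇒≤pred (closed x y x≤ (≤pred-M[1+k]⇒< y≤))))

    in-layer<Mk : ∀ {j k v} → j < k → InLayer j v → v < M * k
    in-layer<Mk j<k (_ , v<) = <-≤-trans v< (*-monoʳ-≤ M j<k)

    H-prefix-closed : ∀ {k} → (∀ j → j < k → LayerMap j) → ∀ x z → pos x < M → pos z < M * k → pos (x ∙ z) < M * k
    H-prefix-closed {k} layers x z x<M z< =
      let (j , w , j<k , w< , gʲw≡z) = layer-decompose layers z<
      in subst (λ v → pos v < M * k) (trans (x∙yz≈y∙xz (pow G g j) x w) (cong (x ∙_) gʲw≡z))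
               (in-layer<Mk j<k (layers j j<k _ (H-closed x w x<M w<)))

    gᵏH-below : ∀ {k} → (∀ j → j < k → LayerMap j) → ∀ {y} → pos y < M → pos (pow G g k ∙ y) < M * k →
                ∀ w → pos w < M → pos (pow G g k ∙ w) < M * k
    gᵏH-below {k} layers {y} y< gᵏy< w w< =
      subst (λ v → pos v < M * k) y⁻¹w∙gᵏy≡gᵏw (H-prefix-closed layers (y ⁻¹ ∙ w) _ (H-closed _ w (pos-⁻¹ y<) w<) gᵏy<)
      where
      y⁻¹w∙gᵏy≡gᵏw : (y ⁻¹ ∙ w) ∙ (pow G g k ∙ y) ≡ pow G g k ∙ w
      y⁻¹w∙gᵏy≡gᵏw = begin
        (y ⁻¹ ∙ w) ∙ (pow G g k ∙ y)   ≡⟨ comm _ _ ⟩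
        (pow G g k ∙ y) ∙ (y ⁻¹ ∙ w)   ≡⟨ assoc _ _ _ ⟩
        pow G g k ∙ (y ∙ (y ⁻¹ ∙ w))   ≡⟨ cong (pow G g k ∙_) (assoc y (y ⁻¹) w) ⟨
        pow G g k ∙ ((y ∙ y ⁻¹) ∙ w)   ≡⟨ cong (λ u → pow G g k ∙ (u ∙ w)) (inverseʳ y) ⟩
        pow G g k ∙ (ε ∙ w)            ≡⟨ cong (pow G g k ∙_) (identityˡ w) ⟩
        pow G g k ∙ w                  ∎
        where open ≡-Reasoning

    g-prefix-closed : ∀ {k} → (∀ j → j < k → LayerMap j) → ∀ {y} → pos y < M → pos (pow G g k ∙ y) < M * k →
                      ∀ z → pos z < M * k → pos (g ∙ z) < M * k
    g-prefix-closed {k} layers y< gᵏy< z z< =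
      let (j , w , j<k , w< , gʲw≡z) = layer-decompose layers z<
      in subst (λ v → pos v < M * k) (trans (assoc g (pow G g j) w) (cong (g ∙_) gʲw≡z))
           ([ (λ 1+j<k → in-layer<Mk 1+j<k (layers (suc j) 1+j<k w w<))
            , (λ 1+j≡k → subst (λ e → pos (pow G g e ∙ w) < M * k) (sym 1+j≡k) (gᵏH-below layers y< gᵏy< w w<))
            ]′ (m≤n⇒m<n∨m≡n j<k))

    -- if some gᵏ y fell below M k, then the prefix [0, M k) would be closed under products with pos ≤ M
    prefix-closed : ∀ {k} → (∀ j → j < k → LayerMap j) → ∀ {y} → pos y < M → pos (pow G g k ∙ y) < M * k →
                    ∀ x z → pos x ≤ M → pos z < M * k → pos (x ∙ z) < M * k
    prefix-closed {k} layers y< gᵏy< x z x≤M z< =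
      [ (λ x<M → H-prefix-closed layers x z x<M z<)
      , (λ pos-x≡M → subst (λ u → pos (u ∙ z) < M * k) (pos-injective g x (trans pos-g (sym pos-x≡M)))
                           (g-prefix-closed layers y< gᵏy< z z<))
      ]′ (m≤n⇒m<n∨m≡n x≤M)

    layerMap : ∀ k → k < m → LayerMap k
    layerMap = <-rec (λ k → k < m → LayerMap k) step
      where
      step : ∀ k → (∀ {j} → j < k → j < m → LayerMap j) → k < m → LayerMap k
      step zero    _  _     y y< = subst (_≤ pos (ε ∙ y)) (sym (*-zeroʳ M)) z≤n
                                 , subst₂ _<_ (cong pos (sym (identityˡ y))) (sym (*-identityʳ M)) y<
      step (suc k) ih 1+k<m y y< = ≮⇒≥ (λ below → layer-not-closed k 1+k<m (prefix-closed layers y< below)) , upper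
        where
        layers : ∀ j → j < suc k → LayerMap j
        layers j j< = ih j< (<-trans j< 1+k<m)
        upper : pos (pow G g (suc k) ∙ y) < M * suc (suc k)
        upper = subst (λ v → pos v < M * suc (suc k)) (sym (assoc g _ y))
                      (layer-upper k 1+k<m g _ (≤-reflexive pos-g) (proj₂ (layers k (n<1+n k) y y<)))

    layer-quotient : ∀ {A B : Subset N} → (∀ {x} → x ∈ A ⇔ pos x < M * m) → (∀ {x} → x ∈ B ⇔ pos x < M) →
                     CyclicQuotientOfOrder G A B m
    layer-quotient {A} {B} A⇔ B⇔ = g , Equivalence.from A⇔ (subst (_< M * m) (sym pos-g) M<Mm) , onto , injective
      where
      onto : ∀ x → x ∈ A → ∃ λ k → k < m × x ∙ pow G g k ⁻¹ ∈ B
      onto x x∈A =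
        let (k , y , k<m , y< , gᵏy≡x) = layer-decompose (λ j j<m → layerMap j j<m) (Equivalence.to A⇔ x∈A)
        in k , k<m , Equivalence.from B⇔ (subst (λ v → pos v < M)
                                          (trans (sym (xyx⁻¹≈y (pow G g k) y)) (cong (_∙ pow G g k ⁻¹) gᵏy≡x)) y<)
      injective : ∀ k l → k < m → l < m → pow G g k ∙ pow G g l ⁻¹ ∈ B → k ≡ l
      injective k l k<m l<m gᵏg⁻ˡ∈B = layer-unique (layerMap k k<m ε (subst (_< M) (sym pos-ε) 0<M))
                                                  (subst (InLayer l ∘ pos) gˡw≡gᵏε (layerMap l l<m _ (Equivalence.to B⇔ gᵏg⁻ˡ∈B)))
        where
        gˡw≡gᵏε : pow G g l ∙ (pow G g k ∙ pow G g l ⁻¹) ≡ pow G g k ∙ ε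
        gˡw≡gᵏε = trans (x∙yz≈y∙xz _ _ _) (trans (cong (pow G g k ∙_) (inverseʳ _)) refl)

  0<place : ∀ (s : Fin (suc (length ns))) → 0 < place (toℕ s) ns
  0<place s = place-positive ns>1 (toℕ s)

  place≤N : ∀ (s : Fin (suc (length ns))) → place (toℕ s) ns ≤ N
  place≤N s = place≤product ns>1 (toℕ s) (s≤s⁻¹ (toℕ<n s))

  Gs : Fin (suc (length ns)) → Subset N
  Gs s = below (0<place s) (place≤N s)

  ∈Gs⇔ : ∀ s {x} → x ∈ Gs s ⇔ pos x < place (toℕ s) ns
  ∈Gs⇔ s = mk⇔ (∈below⇒pos< (0<place s) (place≤N s)) (pos<⇒∈below (0<place s) (place≤N s))

  isFiltration : IsFiltration G ns Gs
  isFiltration = record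
    { subgroup = λ s → closed⇒subgroup (0<place s) (place≤N s) (place-closed (toℕ s) (s≤s⁻¹ (toℕ<n s)))
    ; bottom   = λ s s≡0 → below-1 (0<place s) (place≤N s) (cong (λ t → place t ns) s≡0)
    ; top      = λ s s≡t → below-N (0<place s) (place≤N s) (trans (cong (λ t → place t ns) s≡t) (place-length ns))
    ; incl     = λ s x∈ → Equivalence.from (∈Gs⇔ (Fin.suc s))
                            (<-≤-trans (subst (λ t → _ < place t ns) (toℕ-inject₁ s) (Equivalence.to (∈Gs⇔ (inject₁ s)) x∈))
                                       (place-mono-suc ns>1 (toℕ s)))
    ; quotient = λ s → Layer.layer-quotient s
                         (λ {x} → subst (λ L → x ∈ Gs (Fin.suc s) ⇔ pos x < L) (place-suc ns s) (∈Gs⇔ (Fin.suc s)))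
                         (λ {x} → subst (λ t → x ∈ Gs (inject₁ s) ⇔ pos x < place t ns) (toℕ-inject₁ s) (∈Gs⇔ (inject₁ s)))
    }

realizable⇒filtration : ∀ {ns} → All (1 <_) ns → (G : FiniteAbelianGroup (product ns)) → Realizable G ns → HasFiltration G ns
realizable⇒filtration ns>1 G (F , flag , type≡) = Gs , isFiltration
  where open FromFlag ns>1 G flag type≡

theorem1p8 : (n : ℕ) (G : FiniteAbelianGroup n) (ns : List ℕ) →
    All (1 <_) ns → product ns ≡ n →
    Realizable G ns ⇔ HasFiltration G ns
theorem1p8 .(product ns) G ns ns>1 refl = mk⇔ (realizable⇒filtration ns>1 G) (filtration⇒realizable ns>1 G)
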